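{- Let $d\ge1$ and let $\Psi$ be a nonassociative, noncommutative arithmetic circuit of size $s$ and product depth $\Delta$ computing a polynomial $f\in\mathbb{F}_{\bar{A},\bar{C}}[x_1,\ldots,x_n]$ of degree $d'\le d$. Then there exists an unambiguous circuit $\Psi'$ over $\mathbb{F}[Z]$ computing $\phi(f_{d'})$, where $f_{d'}$ is the homogeneous degree-$d'$ component of $f$. Furthermore, $\Psi'$ has size at most $3d^4s$ and product depth at most $\Delta$.
   Context: $\mathbb{F}_{\bar{A},\bar{C}}[X]$ is the noncommutative, nonassociative polynomial algebra: basis the monomial $1$ and rooted full binary trees with designated left/right children whose leaves are labeled by variables from $X=\{x_1,\ldots,x_n\}$; the product of $m_1,m_2$ is the tree with left subtree $m_1$, right subtree $m_2$; degree = number of leaves. An arithmetic circuit (over this algebra, with product gates having designated left/right children, or over the commutative associative ring $\mathbb{F}[Z]$) is a DAG with leaves labeled by variables or field elements and internal sum gates and fan-in-$2$ product gates; size = number of gates; product depth = max number of product gates on a leaf-to-root path. $Z=\{z_{i,j,k}:i\in[n],j,k\in[d]\}$ are commuting variables. For a monomial $m$ of degree $d'$, $\sigma_m(t)$ is the index of the variable labeling the $t$-th leaf in left-to-right order and $l^m_t$ its level (level $=1+$ distance from the root); $\phi(m)=\prod_{t=1}^{d'}z_{\sigma_m(t),t,l^m_t}$, extended linearly. Unambiguous circuits over $\mathbb{F}[Z]$: parse trees at a gate are defined inductively (a leaf is its own parse tree; at a sum gate attach a parse tree of one child; at a product gate attach parse trees of both children, using disjoint copies). A reduced parse tree is obtained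 by short-circuiting sum gates, removing constant-labeled leaves and contracting single-child nodes; it is a full binary tree with variable-labeled leaves, generating the product of its leaf labels. The circuit is unambiguous if for every monomial $m$ there is a tree $T_m$ such that every reduced parse tree generating $m$ at any gate is identical to $T_m$ as a labeled rooted binary tree. -}

module Defs where

open import Level using (Level) renaming (suc to lsuc; _⊔_ to _⊔ˡ_)
open import Data.Nat using (ℕ; zero; suc; _≤_) renaming (_≟_ to _≟ℕ_)
import Data.Nat as N
open import Data.Fin using (Fin; zero; suc; toℕ)
open import Data.Fin.Properties using (all?) renaming (_≟_ to _≟F_)
open import Data.List using (List; []; _∷_; _++_; concatMap; foldr; map; length)
open import Data.List.Membership.Propositional using (_∈_)
open import Data.Maybe using (Maybe; just; nothing)
open import Data.Product using (_×_; _,_; Σ; ∃; ∃-syntax)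
open import Data.Sum using (_⊎_; inj₁; inj₂)
open import Data.Bool using (Bool; true; false; if_then_else_; _∧_)
open import Relation.Nullary using (Dec; yes; no; ¬_; does)
open import Relation.Nullary.Decidable using (map′)
open import Relation.Binary.PropositionalEquality using (_≡_; refl; cong; cong₂)
open import Algebra.Bundles using (CommutativeRing)

record Field c ℓ : Set (lsuc (c ⊔ˡ ℓ)) where
  field
    commutativeRing : CommutativeRing c ℓ
  open CommutativeRing commutativeRing public
  field
    0≉1     : ¬ (0# ≈ 1#)
    inverse : ∀ x → ¬ (x ≈ 0#) → Σ Carrier λ y → (x * y) ≈ 1#

data BTree (A : Set) : Set where
  leaf : A → BTree A
  node : BTree A → BTree A → BTree A

-- Nonassociative noncommutative monomials over X = {x_1..x_n}:
-- the monomial 1, or a tree with leaves labelled by variables.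
data NMon (n : ℕ) : Set where
  one  : NMon n
  tree : BTree (Fin n) → NMon n

_⊗_ : ∀ {n} → NMon n → NMon n → NMon n
one    ⊗ m      = m
tree t ⊗ one    = tree t
tree t ⊗ tree u = tree (node t u)

leafCount : ∀ {A} → BTree A → ℕ
leafCount (leaf _)   = 1
leafCount (node t u) = leafCount t N.+ leafCount u

deg : ∀ {n} → NMon n → ℕ
deg one      = 0
deg (tree t) = leafCount t

btree-≟ : ∀ {n} (t u : BTree (Fin n)) → Dec (t ≡ u)
btree-≟ (leaf a) (leaf b) with a ≟F b
... | yes refl = yes refl
... | no a≢b   = no λ { refl → a≢b refl }
btree-≟ (leaf _) (node _ _) = no λ ()
btree-≟ (node _ _) (leaf _) = no λ ()
btree-≟ (node t₁ t₂) (node u₁ u₂) with btree-≟ t₁ u₁ | btree-≟ t₂ u₂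
... | yes refl | yes refl = yes refl
... | no p      | _        = no λ { refl → p refl }
... | yes _     | no q     = no λ { refl → q refl }

nmon-≟ : ∀ {n} (m m′ : NMon n) → Dec (m ≡ m′)
nmon-≟ one one = yes refl
nmon-≟ one (tree _) = no λ ()
nmon-≟ (tree _) one = no λ ()
nmon-≟ (tree t) (tree u) with btree-≟ t u
... | yes refl = yes refl
... | no p     = no λ { refl → p refl }

-- Commuting variables Z = { z_{i,j,k} : i ∈ [n], j,k ∈ [d] }
-- (indices j,k are 0-based: Fin d element j stands for j+1).
-- A commutative monomial in Z is an exponent vector.

ZVar : ℕ → ℕ → Set
ZVar n d = Fin n × Fin d × Fin d

CMon : ℕ → ℕ → Set
CMon n d = Fin n → Fin d → Fin d → ℕ

cone : ∀ {n d} → CMon n d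
cone _ _ _ = 0

cvar : ∀ {n d} → ZVar n d → CMon n d
cvar (i , j , k) i′ j′ k′ =
  if does (i ≟F i′) ∧ does (j ≟F j′) ∧ does (k ≟F k′) then 1 else 0

_⊕_ : ∀ {n d} → CMon n d → CMon n d → CMon n d
(μ ⊕ ν) i j k = μ i j k N.+ ν i j k

cmon-≟ : ∀ {n d} (μ ν : CMon n d) → Dec (∀ i j k → μ i j k ≡ ν i j k)
cmon-≟ μ ν = all? λ i → all? λ j → all? λ k → μ i j k ≟ℕ ν i j k

-- Arithmetic circuits (DAGs), in topological order.
-- A circuit of size s is a list of s gates; the gate at the head may only
-- refer (via Fin s) to gates in the tail, where index 0 is the head of
-- the tail.  The output (root) gate is the head gate.

data Gate {c} (L : Set) (C : Set c) (s : ℕ) : Set c where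
  var  : L → Gate L C s
  cst  : C → Gate L C s
  add  : List (Fin s) → Gate L C s
  mul  : Fin s → Fin s → Gate L C s

data Circuit {c} (L : Set) (C : Set c) : ℕ → Set c where
  []  : Circuit L C 0
  _∷_ : ∀ {s} → Gate L C s → Circuit L C s → Circuit L C (suc s)

size : ∀ {c L} {C : Set c} {s} → Circuit L C s → ℕ
size {s = s} _ = s

maxL : List ℕ → ℕ
maxL = foldr N._⊔_ 0

pdepthAt : ∀ {c L} {C : Set c} {s} → Circuit L C s → Fin s → ℕ
pdepthAt (var _   ∷ Ψ) zero = 0
pdepthAt (cst _   ∷ Ψ) zero = 0
pdepthAt (add ks  ∷ Ψ) zero = maxL (map (pdepthAt Ψ) ks)
pdepthAt (mul a b ∷ Ψ) zero = suc (pdepthAt Ψ a N.⊔ pdepthAt Ψ b)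
pdepthAt (g ∷ Ψ) (suc k)    = pdepthAt Ψ k

pdepth : ∀ {c L} {C : Set c} {s} → Circuit L C (suc s) → ℕ
pdepth Ψ = pdepthAt Ψ zero

-- Polynomials over a field, as formal finite sums of monomials; two
-- polynomials are equal iff all their coefficients are ≈-equal.

module Poly {c ℓ} (F : Field c ℓ) where
  open Field F using (Carrier; _≈_; _+_; _*_; 0#; 1#)

  FSum : Set → Set c
  FSum M = List (Carrier × M)

  sumC : List Carrier → Carrier
  sumC = foldr _+_ 0#

  coeffBy : ∀ {M : Set} {P : M → M → Set} →
            (∀ m m′ → Dec (P m m′)) → FSum M → M → Carrier
  coeffBy eq []             m = 0#
  coeffBy eq ((a , m′) ∷ p) m with eq m′ m
  ... | yes _ = a + coeffBy eq p m
  ... | no  _ = coeffBy eq p m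

  mulBy : ∀ {M : Set} → (M → M → M) → FSum M → FSum M → FSum M
  mulBy _·_ p q = concatMap (λ { (a , m) → map (λ { (b , m′) → (a * b , m · m′) }) q }) p

  NPoly : ℕ → Set c
  NPoly n = FSum (NMon n)

  ncoeff : ∀ {n} → NPoly n → NMon n → Carrier
  ncoeff = coeffBy nmon-≟

  ZPoly : ℕ → ℕ → Set c
  ZPoly n d = FSum (CMon n d)

  zcoeff : ∀ {n d} → ZPoly n d → CMon n d → Carrier
  zcoeff = coeffBy cmon-≟

  _≈N_ : ∀ {n} → NPoly n → NPoly n → Set ℓ
  p ≈N q = ∀ m → ncoeff p m ≈ ncoeff q m

  _≈Z_ : ∀ {n d} → ZPoly n d → ZPoly n d → Set ℓ
  p ≈Z q = ∀ μ → zcoeff p μ ≈ zcoeff q μ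

  HasDegree : ∀ {n} → NPoly n → ℕ → Set ℓ
  HasDegree f d′ =
    (Σ (NMon _) λ m → deg m ≡ d′ × ¬ (ncoeff f m ≈ 0#)) ×
    (∀ m → ¬ (ncoeff f m ≈ 0#) → deg m ≤ d′)

  homog : ∀ {n} → ℕ → NPoly n → NPoly n
  homog d′ [] = []
  homog d′ ((a , m) ∷ p) with deg m ≟ℕ d′
  ... | yes _ = (a , m) ∷ homog d′ p
  ... | no  _ = homog d′ p

  leavesAt : ∀ {n} → ℕ → BTree (Fin n) → List (Fin n × ℕ)
  leavesAt l (leaf a)   = (a , l) ∷ []
  leavesAt l (node t u) = leavesAt (suc l) t ++ leavesAt (suc l) u

  leaves : ∀ {n} → NMon n → List (Fin n × ℕ)
  leaves one      = []
  leaves (tree t) = leavesAt 1 t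

  lookupL : ∀ {A : Set} → List A → ℕ → Maybe A
  lookupL []       _       = nothing
  lookupL (x ∷ xs) zero    = just x
  lookupL (x ∷ xs) (suc t) = lookupL xs t

  -- φ(m) = ∏_t z_{σ_m(t), t, l^m_t}; exponent of z_{i,j,k}
  -- (j,k ∈ Fin d standing for j+1, k+1)
  φmon : ∀ {n d} → NMon n → CMon n d
  φmon m i j k with lookupL (leaves m) (toℕ j)
  ... | nothing      = 0
  ... | just (a , l) =
    if does (a ≟F i) ∧ does (l ≟ℕ suc (toℕ k)) then 1 else 0

  φ : ∀ {n d} → NPoly n → ZPoly n d
  φ = map λ { (a , m) → (a , φmon m) }

  NCircuit : ℕ → ℕ → Set c
  NCircuit n s = Circuit (Fin n) Carrier s

  ZCircuit : ℕ → ℕ → ℕ → Set c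
  ZCircuit n d s = Circuit (ZVar n d) Carrier s

  evalAt : ∀ {L M : Set} → (L → M) → M → (M → M → M) →
           ∀ {s} → Circuit L Carrier s → Fin s → FSum M
  evalAt v u _·_ (var x   ∷ Ψ) zero = (1# , v x) ∷ []
  evalAt v u _·_ (cst a   ∷ Ψ) zero = (a , u) ∷ []
  evalAt v u _·_ (add ks  ∷ Ψ) zero = concatMap (evalAt v u _·_ Ψ) ks
  evalAt v u _·_ (mul a b ∷ Ψ) zero =
    mulBy _·_ (evalAt v u _·_ Ψ a) (evalAt v u _·_ Ψ b)
  evalAt v u _·_ (g ∷ Ψ) (suc k) = evalAt v u _·_ Ψ k

  nOutput : ∀ {n s} → NCircuit n (suc s) → NPoly n
  nOutput Ψ = evalAt (λ x → tree (leaf x)) one _⊗_ Ψ zero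

  zOutput : ∀ {n d s} → ZCircuit n d (suc s) → ZPoly n d
  zOutput Ψ = evalAt cvar cone _⊕_ Ψ zero

  -- joining reduced subtrees (a removed subtree is `nothing`; a product
  -- node with one removed child is contracted to the other child)
  join : ∀ {A : Set} → Maybe (BTree A) → Maybe (BTree A) → Maybe (BTree A)
  join nothing  r        = r
  join (just t) nothing  = just t
  join (just t) (just u) = just (node t u)

  -- RPT Ψ g r : r is (the result of reducing) a parse tree at gate g
  data RPT {n d : ℕ} : ∀ {s} → ZCircuit n d s → Fin s → Maybe (BTree (ZVar n d)) → Set c where
    rvar  : ∀ {s} {Ψ : ZCircuit n d s} z → RPT (var z ∷ Ψ) zero (just (leaf z))
    rcst  : ∀ {s} {Ψ : ZCircuit n d s} a → RPT (cst a ∷ Ψ) zero nothing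
    radd  : ∀ {s} {Ψ : ZCircuit n d s} {ks k r} →
            k ∈ ks → RPT Ψ k r → RPT (add ks ∷ Ψ) zero r
    rmul  : ∀ {s} {Ψ : ZCircuit n d s} {a b r₁ r₂} →
            RPT Ψ a r₁ → RPT Ψ b r₂ → RPT (mul a b ∷ Ψ) zero (join r₁ r₂)
    there : ∀ {s} {Ψ : ZCircuit n d s} {g k r} →
            RPT Ψ k r → RPT (g ∷ Ψ) (suc k) r

  genT : ∀ {n d} → BTree (ZVar n d) → CMon n d
  genT (leaf z)   = cvar z
  genT (node t u) = genT t ⊕ genT u

  gen : ∀ {n d} → Maybe (BTree (ZVar n d)) → CMon n d
  gen nothing  = cone
  gen (just t) = genT t

  Unambiguous : ∀ {n d s} → ZCircuit n d s → Set c
  Unambiguous {n} {d} {s} Ψ =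
    ∀ (μ : CMon n d) → ∃[ T ] ∀ (g : Fin s) r →
      RPT Ψ g r → (∀ i j k → gen r i j k ≡ μ i j k) → r ≡ T

module Submission where

-- Every gate v of Ψ is replaced by a block of gates, one for each slot (p , l , e): it computes
-- φ of the degree-e part of the polynomial at v, shifted so that the leaves of each monomial
-- start at position p and its root lies at level l.  Sum gates are copied slotwise.  A product
-- gate becomes the sum over the degree e₁ of its left factor of the products of the slots
-- (p , l+1 , e₁) and (p+e₁ , l+1 , e-e₁) of its children; a factor of degree 0 is the monomial
-- one, which adds no node, so the other factor keeps the slot (p , l , e).  Every reduced parse
-- tree at a slot gate then has its leaves at the positions p, p+1, ... and at the levels l plus
-- their depths.  The monomial it generates therefore lists its leaf labels in order, the Kraft
-- sum of their levels fixes l, and the labels with their levels fix the tree: the new circuit is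
-- unambiguous.  There are d³ + 1 slots and d + 2 gates per slot, which is within 3 d⁴ gates per
-- gate of Ψ when d ≥ 2; for d = 1 the parts of degree at most one are built directly.

open import Defs
open import Level using () renaming (_⊔_ to _⊔ˡ_)
open import Data.Bool as Bool using (true; false; if_then_else_; _∧_)
open import Data.Empty using (⊥; ⊥-elim)
open import Data.Unit using (⊤; tt)
open import Data.Nat using (ℕ; zero; suc; _+_; _∸_; _*_; _^_; _⊔_; _≤_; _<_; _≤?_; _<?_; _≡ᵇ_; z≤n; s≤s; NonZero)
  renaming (_≟_ to _≟ℕ_)
open import Data.Nat.Properties
open import Data.Nat.DivMod using (_/_; _%_; m≡m%n+[m/n]*n; [m+kn]%n≡m%n; m<n⇒m%n≡m; m%n<n; m<n*o⇒m/o<n)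
open import Data.Nat.Induction using (<-rec)
open import Data.Nat.Solver using (module +-*-Solver)
open import Data.Fin using (Fin; zero; suc; toℕ; fromℕ<; opposite) renaming (_≟_ to _≟F_)
open import Data.Fin.Properties using (toℕ<n; toℕ-fromℕ<; toℕ-fromℕ; toℕ-inject₁; opposite-involutive; toℕ-injective)
open import Data.List using (List; []; _∷_; map; concat; concatMap; _++_; length; downFrom; upTo; allFin; cartesianProduct; deduplicate)
open import Data.List.Properties
  using (map-∘; map-cong; map-cong-local; map-++; concatMap-map; length-++; length-filter; ∷-injective; ++-assoc; ++-identityʳ)
open import Data.List.Membership.Propositional using (_∈_; lose; find)
open import Data.List.Membership.Propositional.Properties
  using (∈-map⁺; ∈-map⁻; ∈-concatMap⁺; ∈-concatMap⁻; ∈-++⁺ˡ; ∈-++⁺ʳ; ∈-++⁻; ∈-allFin; ∈-upTo⁺; ∈-downFrom⁻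
        ; ∈-cartesianProduct⁺; ∈-deduplicate⁺)
open import Data.List.Relation.Unary.Any using (here; there; any?; satisfied)
open import Data.List.Relation.Unary.All as All using (All; []; _∷_)
open import Data.List.Relation.Unary.All.Properties using () renaming (map⁺ to All-map⁺; ++⁺ to All-++⁺)
open import Data.List.Relation.Unary.Unique.Propositional using (Unique; []; _∷_)
open import Data.List.Relation.Unary.Unique.DecPropositional.Properties using (deduplicate-!)
open import Data.List.Relation.Binary.Pointwise using ([]; _∷_)
import Data.List.Relation.Binary.Permutation.Setoid as Permutation
import Data.List.Relation.Binary.Permutation.Setoid.Properties as PermutationProperties
open import Data.Maybe using (Maybe; just; nothing)
open import Data.Product using (Σ; ∃; _×_; _,_; proj₁; proj₂)
open import Data.Sum using (_⊎_; inj₁; inj₂)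
open import Function using (_∘_)
open import Relation.Nullary using (Dec; yes; no; ¬_; does)
open import Relation.Nullary.Decidable using (_×-dec_)
open import Relation.Binary.Bundles using (Setoid)
open import Relation.Binary.Definitions using (DecidableEquality; tri<; tri≈; tri>)
open import Relation.Binary.PropositionalEquality as ≡ using (_≡_; _≢_; refl; sym; trans; cong; cong₂; subst; module ≡-Reasoning)
import Relation.Binary.Reasoning.Setoid as ≈-Reasoning


-- Circuits given by gate functions

data AbsGate {c} (L : Set) (C : Set c) : Set c where
  gvar : L → AbsGate L C
  gcst : C → AbsGate L C
  gadd : List ℕ → AbsGate L C
  gmul : ℕ → ℕ → AbsGate L C

-- Gates are numbered from the bottom of the list: in a circuit with m gates
-- the head has absolute index m ∸ 1, and the relative index x into a tail
-- with m gates points to absolute index m ∸ suc x.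
absIndex : ∀ {m} → Fin m → ℕ
absIndex x = toℕ (opposite x)

absIndex<m : ∀ {m} (x : Fin m) → absIndex x < m
absIndex<m x = toℕ<n (opposite x)

absIndex-zero : ∀ {m} → absIndex {suc m} zero ≡ m
absIndex-zero {m} = toℕ-fromℕ m

absIndex-suc : ∀ {m} (x : Fin m) → absIndex (suc x) ≡ absIndex x
absIndex-suc x = toℕ-inject₁ (opposite x)

relIndex : ∀ {m k} → k < m → Fin m
relIndex k<m = opposite (fromℕ< k<m)

absIndex-relIndex : ∀ {m k} (k<m : k < m) → absIndex (relIndex k<m) ≡ k
absIndex-relIndex k<m = trans (cong toℕ (opposite-involutive (fromℕ< k<m))) (toℕ-fromℕ< k<m)

relIndices : ∀ {m} ks → All (_< m) ks → List (Fin m)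
relIndices []       []         = []
relIndices (k ∷ ks) (k<m ∷ ps) = relIndex k<m ∷ relIndices ks ps

absIndex-relIndices : ∀ {m} ks (ps : All (_< m) ks) → map absIndex (relIndices ks ps) ≡ ks
absIndex-relIndices []       []         = refl
absIndex-relIndices (k ∷ ks) (k<m ∷ ps) = cong₂ _∷_ (absIndex-relIndex k<m) (absIndex-relIndices ks ps)

module _ {c} {L : Set} {C : Set c} where

  absGate : ∀ {m} → Gate L C m → AbsGate L C
  absGate (var z)   = gvar z
  absGate (cst a)   = gcst a
  absGate (add ks)  = gadd (map absIndex ks)
  absGate (mul x y) = gmul (absIndex x) (absIndex y)

  -- Out of range the gate is the empty sum, which has no parse trees.
  gateAt : ∀ {m} → Circuit L C m → ℕ → AbsGate L C
  gateAt []              b = gadd []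
  gateAt (_∷_ {m} g Ψ) b with b ≟ℕ m
  ... | yes _ = absGate g
  ... | no  _ = gateAt Ψ b

  RefsBelow : ℕ → AbsGate L C → Set
  RefsBelow b (gvar _)   = ⊤
  RefsBelow b (gcst _)   = ⊤
  RefsBelow b (gadd ks)  = All (_< b) ks
  RefsBelow b (gmul x y) = x < b × y < b

  absGate-refsBelow : ∀ {m} (g : Gate L C m) → RefsBelow m (absGate g)
  absGate-refsBelow (var _)   = tt
  absGate-refsBelow (cst _)   = tt
  absGate-refsBelow (add ks)  = All-map⁺ (All.tabulate λ {x} _ → absIndex<m x)
  absGate-refsBelow (mul x y) = absIndex<m x , absIndex<m y

  gateAt-refsBelow : ∀ {m} (Ψ : Circuit L C m) b → RefsBelow b (gateAt Ψ b)
  gateAt-refsBelow []              b = []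
  gateAt-refsBelow (_∷_ {m} g Ψ) b with b ≟ℕ m
  ... | yes refl = absGate-refsBelow g
  ... | no  _    = gateAt-refsBelow Ψ b

  gateAt-beyond : ∀ {m} (Ψ : Circuit L C m) b → m ≤ b → gateAt Ψ b ≡ gadd []
  gateAt-beyond []              b m≤b = refl
  gateAt-beyond (_∷_ {m} g Ψ) b m<b with b ≟ℕ m
  ... | yes refl with () ← <-irrefl refl m<b
  ... | no  _    = gateAt-beyond Ψ b (<⇒≤ m<b)

  gateAt-tail : ∀ {m} (g : Gate L C m) (Ψ : Circuit L C m) {b} → b < m → gateAt (g ∷ Ψ) b ≡ gateAt Ψ b
  gateAt-tail {m} g Ψ {b} b<m with b ≟ℕ m
  ... | yes refl with () ← <-irrefl refl b<m
  ... | no  _    = refl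

  gateAt-head : ∀ {m} (g : Gate L C m) (Ψ : Circuit L C m) → gateAt (g ∷ Ψ) m ≡ absGate g
  gateAt-head {m} g Ψ with m ≟ℕ m
  ... | yes _   = refl
  ... | no  m≢m with () ← m≢m refl

  relGate : ∀ m (g : AbsGate L C) → RefsBelow m g → Gate L C m
  relGate m (gvar z)   _           = var z
  relGate m (gcst a)   _           = cst a
  relGate m (gadd ks)  ps          = add (relIndices ks ps)
  relGate m (gmul x y) (x<m , y<m) = mul (relIndex x<m) (relIndex y<m)

  absGate-relGate : ∀ m (g : AbsGate L C) (p : RefsBelow m g) → absGate (relGate m g p) ≡ g
  absGate-relGate m (gvar z)   _           = refl
  absGate-relGate m (gcst a)   _           = refl
  absGate-relGate m (gadd ks)  ps          = cong gadd (absIndex-relIndices ks ps)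
  absGate-relGate m (gmul x y) (x<m , y<m) = cong₂ gmul (absIndex-relIndex x<m) (absIndex-relIndex y<m)

  circuit : ∀ N (G : ℕ → AbsGate L C) → (∀ b → b < N → RefsBelow b (G b)) → Circuit L C N
  circuit zero    G wf = []
  circuit (suc N) G wf = relGate N (G N) (wf N ≤-refl) ∷ circuit N G (λ b b<N → wf b (m<n⇒m<1+n b<N))

  gateAt-circuit : ∀ N (G : ℕ → AbsGate L C) wf b → b < N → gateAt (circuit N G wf) b ≡ G b
  gateAt-circuit (suc N) G wf b b<1+N with b ≟ℕ N
  ... | yes refl = absGate-relGate N (G N) (wf N ≤-refl)
  ... | no  b≢N  = gateAt-circuit N G _ b (≤∧≢⇒< (≤-pred b<1+N) b≢N)

module AbsFold {c a} {L : Set} {C : Set c} {A : Set a}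
  (step : AbsGate L C → (ℕ → A) → A)
  (step-local : ∀ b g {E E′} → RefsBelow b g → (∀ k → k < b → E k ≡ E′ k) → step g E ≡ step g E′)
  (junk : A) where

  foldAt : ∀ {m} → Circuit L C m → ℕ → A
  foldAt []              b = junk
  foldAt (_∷_ {m} g Ψ) b with b ≟ℕ m
  ... | yes _ = step (absGate g) (foldAt Ψ)
  ... | no  _ = foldAt Ψ b

  foldAt-head : ∀ {m} (g : Gate L C m) (Ψ : Circuit L C m) → foldAt (g ∷ Ψ) m ≡ step (absGate g) (foldAt Ψ)
  foldAt-head {m} g Ψ with m ≟ℕ m
  ... | yes _   = refl
  ... | no  m≢m with () ← m≢m refl

  foldAt-tail : ∀ {m} (g : Gate L C m) (Ψ : Circuit L C m) {b} → b < m → foldAt (g ∷ Ψ) b ≡ foldAt Ψ b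
  foldAt-tail {m} g Ψ {b} b<m with b ≟ℕ m
  ... | yes refl with () ← <-irrefl refl b<m
  ... | no  _    = refl

  foldAt-local : ∀ {m} (Ψ : Circuit L C m) b → b < m → foldAt Ψ b ≡ step (gateAt Ψ b) (foldAt Ψ)
  foldAt-local (_∷_ {m} g Ψ) b b<1+m with b ≟ℕ m
  ... | yes refl = step-local m (absGate g) (absGate-refsBelow g) λ k k<m → sym (foldAt-tail g Ψ k<m)
  ... | no  b≢m  = trans (foldAt-local Ψ b b<m)
                     (step-local b (gateAt Ψ b) (gateAt-refsBelow Ψ b) λ k k<b → sym (foldAt-tail g Ψ (<-trans k<b b<m)))
    where b<m = ≤∧≢⇒< (≤-pred b<1+m) b≢m

  foldAt-circuit : ∀ N (G : ℕ → AbsGate L C) wf b → b < N → foldAt (circuit N G wf) b ≡ step (G b) (foldAt (circuit N G wf))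
  foldAt-circuit N G wf b b<N =
    trans (foldAt-local (circuit N G wf) b b<N) (cong (λ g → step g _) (gateAt-circuit N G wf b b<N))

  foldAt-absIndex : (sem : ∀ {m} → Circuit L C m → Fin m → A) →
    (∀ {m} (g : Gate L C m) Ψ x → sem (g ∷ Ψ) (suc x) ≡ sem Ψ x) →
    (∀ {m} (g : Gate L C m) Ψ → (∀ x → foldAt Ψ (absIndex x) ≡ sem Ψ x) →
       sem (g ∷ Ψ) zero ≡ step (absGate g) (foldAt Ψ)) →
    ∀ {m} (Ψ : Circuit L C m) x → foldAt Ψ (absIndex x) ≡ sem Ψ x
  foldAt-absIndex sem sem-suc sem-zero (_∷_ {m} g Ψ) zero = begin
    foldAt (g ∷ Ψ) (absIndex {suc m} zero) ≡⟨ cong (foldAt (g ∷ Ψ)) (absIndex-zero {m}) ⟩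
    foldAt (g ∷ Ψ) m                ≡⟨ foldAt-head g Ψ ⟩
    step (absGate g) (foldAt Ψ)     ≡⟨ sym (sem-zero g Ψ (foldAt-absIndex sem sem-suc sem-zero Ψ)) ⟩
    sem (g ∷ Ψ) zero                ∎
    where open ≡-Reasoning
  foldAt-absIndex sem sem-suc sem-zero (g ∷ Ψ) (suc x) = begin
    foldAt (g ∷ Ψ) (absIndex (suc x)) ≡⟨ cong (foldAt (g ∷ Ψ)) (absIndex-suc x) ⟩
    foldAt (g ∷ Ψ) (absIndex x)       ≡⟨ foldAt-tail g Ψ (absIndex<m x) ⟩
    foldAt Ψ (absIndex x)             ≡⟨ foldAt-absIndex sem sem-suc sem-zero Ψ x ⟩
    sem Ψ x                           ≡⟨ sym (sem-suc g Ψ x) ⟩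
    sem (g ∷ Ψ) (suc x)               ∎
    where open ≡-Reasoning

map-local : ∀ {a} {A : Set a} b {E E′ : ℕ → A} ks → All (_< b) ks → (∀ k → k < b → E k ≡ E′ k) → map E ks ≡ map E′ ks
map-local b ks ps eq = map-cong-local (All.map (λ {k} → eq k) ps)

module _ {c} {L : Set} {C : Set c} where

  depthStep : AbsGate L C → (ℕ → ℕ) → ℕ
  depthStep (gvar _)   P = 0
  depthStep (gcst _)   P = 0
  depthStep (gadd ks)  P = maxL (map P ks)
  depthStep (gmul x y) P = suc (P x ⊔ P y)

  depthStep-local : ∀ b g {P P′} → RefsBelow b g → (∀ k → k < b → P k ≡ P′ k) → depthStep g P ≡ depthStep g P′
  depthStep-local b (gvar _)   _           eq = refl
  depthStep-local b (gcst _)   _           eq = refl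
  depthStep-local b (gadd ks)  ps          eq = cong maxL (map-local b ks ps eq)
  depthStep-local b (gmul x y) (x<b , y<b) eq = cong suc (cong₂ _⊔_ (eq x x<b) (eq y y<b))

  open AbsFold depthStep depthStep-local 0 public using () renaming
    (foldAt to depthAt; foldAt-local to depthAt-local; foldAt-circuit to depthAt-circuit)

  depthAt-absIndex : ∀ {m} (Ψ : Circuit L C m) x → depthAt Ψ (absIndex x) ≡ pdepthAt Ψ x
  depthAt-absIndex = AbsFold.foldAt-absIndex depthStep depthStep-local 0 pdepthAt pdepthAt-suc pdepthAt-zero
    where
      pdepthAt-suc : ∀ {m} (g : Gate L C m) Ψ x → pdepthAt (g ∷ Ψ) (suc x) ≡ pdepthAt Ψ x
      pdepthAt-suc (var _)   Ψ x = refl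
      pdepthAt-suc (cst _)   Ψ x = refl
      pdepthAt-suc (add _)   Ψ x = refl
      pdepthAt-suc (mul _ _) Ψ x = refl
      pdepthAt-zero : ∀ {m} (g : Gate L C m) Ψ → (∀ x → depthAt Ψ (absIndex x) ≡ pdepthAt Ψ x) →
                      pdepthAt (g ∷ Ψ) zero ≡ depthStep (absGate g) (depthAt Ψ)
      pdepthAt-zero (var _)   Ψ ih = refl
      pdepthAt-zero (cst _)   Ψ ih = refl
      pdepthAt-zero (add ks)  Ψ ih = cong maxL (trans (map-cong (sym ∘ ih) ks) (map-∘ ks))
      pdepthAt-zero (mul x y) Ψ ih = cong suc (sym (cong₂ _⊔_ (ih x) (ih y)))

  pdepth-depthAt : ∀ {s} (Ψ : Circuit L C (suc s)) → pdepth Ψ ≡ depthAt Ψ s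
  pdepth-depthAt {s} Ψ = trans (sym (depthAt-absIndex Ψ zero)) (cong (depthAt Ψ) (absIndex-zero {s}))

maxL-map-≤ : ∀ {a} {A : Set a} (f : A → ℕ) xs {B} → (∀ x → x ∈ xs → f x ≤ B) → maxL (map f xs) ≤ B
maxL-map-≤ f []       f≤B = z≤n
maxL-map-≤ f (x ∷ xs) f≤B = ⊔-lub (f≤B x (here refl)) (maxL-map-≤ f xs λ y y∈ → f≤B y (there y∈))

maxL-map-mono : ∀ {a} {A : Set a} (f g : A → ℕ) xs → (∀ x → x ∈ xs → f x ≤ g x) → maxL (map f xs) ≤ maxL (map g xs)
maxL-map-mono f g []       f≤g = z≤n
maxL-map-mono f g (x ∷ xs) f≤g = ⊔-mono-≤ (f≤g x (here refl)) (maxL-map-mono f g xs λ y y∈ → f≤g y (there y∈))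

≤-maxL-map : ∀ {a} {A : Set a} (f : A → ℕ) {x xs} → x ∈ xs → f x ≤ maxL (map f xs)
≤-maxL-map f (here refl) = m≤m⊔n _ _
≤-maxL-map f {xs = y ∷ _} (there x∈) = ≤-trans (≤-maxL-map f x∈) (m≤n⊔m (f y) _)

module _ {c ℓ} (F : Field c ℓ) where
  open Field F using (Carrier; 1#)
  open Poly F

  module Evaluation {L M : Set} (v : L → M) (u : M) (_·_ : M → M → M) where

    evalStep : AbsGate L Carrier → (ℕ → FSum M) → FSum M
    evalStep (gvar z)   E = (1# , v z) ∷ []
    evalStep (gcst a)   E = (a , u) ∷ []
    evalStep (gadd ks)  E = concatMap E ks
    evalStep (gmul x y) E = mulBy _·_ (E x) (E y)

    evalStep-local : ∀ b g {E E′} → RefsBelow b g → (∀ k → k < b → E k ≡ E′ k) → evalStep g E ≡ evalStep g E′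
    evalStep-local b (gvar _)   _           eq = refl
    evalStep-local b (gcst _)   _           eq = refl
    evalStep-local b (gadd ks)  ps          eq = cong concat (map-local b ks ps eq)
    evalStep-local b (gmul x y) (x<b , y<b) eq = cong₂ (mulBy _·_) (eq x x<b) (eq y y<b)

    open AbsFold evalStep evalStep-local [] public using () renaming
      (foldAt to valueAt; foldAt-local to valueAt-local; foldAt-circuit to valueAt-circuit)

    valueAt-absIndex : ∀ {m} (Ψ : Circuit L Carrier m) x → valueAt Ψ (absIndex x) ≡ evalAt v u _·_ Ψ x
    valueAt-absIndex = AbsFold.foldAt-absIndex evalStep evalStep-local [] (evalAt v u _·_) evalAt-suc evalAt-zero
      where
        evalAt-suc : ∀ {m} (g : Gate L Carrier m) Ψ x → evalAt v u _·_ (g ∷ Ψ) (suc x) ≡ evalAt v u _·_ Ψ x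
        evalAt-suc (var _)   Ψ x = refl
        evalAt-suc (cst _)   Ψ x = refl
        evalAt-suc (add _)   Ψ x = refl
        evalAt-suc (mul _ _) Ψ x = refl
        evalAt-zero : ∀ {m} (g : Gate L Carrier m) Ψ → (∀ x → valueAt Ψ (absIndex x) ≡ evalAt v u _·_ Ψ x) →
                      evalAt v u _·_ (g ∷ Ψ) zero ≡ evalStep (absGate g) (valueAt Ψ)
        evalAt-zero (var _)   Ψ ih = refl
        evalAt-zero (cst _)   Ψ ih = refl
        evalAt-zero (add ks)  Ψ ih = cong concat (trans (map-cong (sym ∘ ih) ks) (map-∘ ks))
        evalAt-zero (mul x y) Ψ ih = sym (cong₂ (mulBy _·_) (ih x) (ih y))

    evalAt-zero-valueAt : ∀ {s} (Ψ : Circuit L Carrier (suc s)) → evalAt v u _·_ Ψ zero ≡ valueAt Ψ s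
    evalAt-zero-valueAt {s} Ψ = trans (sym (valueAt-absIndex Ψ zero)) (cong (valueAt Ψ) (absIndex-zero {s}))

  module _ {n d : ℕ} where

    data Parse (G : ℕ → AbsGate (ZVar n d) Carrier) : ℕ → Maybe (BTree (ZVar n d)) → Set c where
      pvar : ∀ {b z} → G b ≡ gvar z → Parse G b (just (leaf z))
      pcst : ∀ {b a} → G b ≡ gcst a → Parse G b nothing
      padd : ∀ {b ks k r} → G b ≡ gadd ks → k ∈ ks → Parse G k r → Parse G b r
      pmul : ∀ {b x y r₁ r₂} → G b ≡ gmul x y → Parse G x r₁ → Parse G y r₂ → Parse G b (join r₁ r₂)

    noParse-empty : ∀ {G b r} → G b ≡ gadd [] → Parse G b r → ⊥
    noParse-empty e (pvar e′)        with () ← trans (sym e) e′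
    noParse-empty e (pcst e′)        with () ← trans (sym e) e′
    noParse-empty e (padd e′ k∈ _)   with refl ← trans (sym e) e′ with () ← k∈
    noParse-empty e (pmul e′ _ _)    with () ← trans (sym e) e′

    Parse-below : ∀ {G N b r} → (∀ b → N ≤ b → G b ≡ gadd []) → Parse G b r → b < N
    Parse-below {N = N} {b} beyond p with b <? N
    ... | yes b<N = b<N
    ... | no  b≮N = ⊥-elim (noParse-empty (beyond b (≮⇒≥ b≮N)) p)

    Parse-transport : ∀ {G G′ N} → (∀ b → b < N → G b ≡ G′ b) → (∀ b → N ≤ b → G b ≡ gadd []) →
                      ∀ {b r} → Parse G b r → Parse G′ b r
    Parse-transport {G} {G′} agree beyond = go
      where
        retarget : ∀ {b r g} → Parse G b r → G b ≡ g → G′ b ≡ g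
        retarget p e = trans (sym (agree _ (Parse-below beyond p))) e
        go : ∀ {b r} → Parse G b r → Parse G′ b r
        go p@(pvar e)       = pvar (retarget p e)
        go p@(pcst e)       = pcst (retarget p e)
        go p@(padd e k∈ q)  = padd (retarget p e) k∈ (go q)
        go p@(pmul e q₁ q₂) = pmul (retarget p e) (go q₁) (go q₂)

    gateAt-zero : ∀ {m} g (Ψ : ZCircuit n d m) → gateAt (g ∷ Ψ) (absIndex {suc m} zero) ≡ absGate g
    gateAt-zero {m} g Ψ = trans (cong (gateAt (g ∷ Ψ)) (absIndex-zero {m})) (gateAt-head g Ψ)

    Parse-tail : ∀ {m} g (Ψ : ZCircuit n d m) {b r} → Parse (gateAt Ψ) b r → Parse (gateAt (g ∷ Ψ)) b r
    Parse-tail g Ψ = Parse-transport (λ b b<m → sym (gateAt-tail g Ψ b<m)) (gateAt-beyond Ψ)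

    RPT→Parse : ∀ {m} {Ψ : ZCircuit n d m} {g r} → RPT Ψ g r → Parse (gateAt Ψ) (absIndex g) r
    RPT→Parse (rvar {Ψ = Ψ} z)           = pvar (gateAt-zero (var z) Ψ)
    RPT→Parse (rcst {Ψ = Ψ} a)           = pcst (gateAt-zero (cst a) Ψ)
    RPT→Parse (radd {Ψ = Ψ} {ks} k∈ p)   = padd (gateAt-zero (add ks) Ψ) (∈-map⁺ absIndex k∈) (Parse-tail (add ks) Ψ (RPT→Parse p))
    RPT→Parse (rmul {Ψ = Ψ} {x} {y} p q) = pmul (gateAt-zero (mul x y) Ψ) (Parse-tail _ Ψ (RPT→Parse p)) (Parse-tail _ Ψ (RPT→Parse q))
    RPT→Parse (there {Ψ = Ψ} {g} {k} p)  = subst (λ b → Parse _ b _) (sym (absIndex-suc k)) (Parse-tail g Ψ (RPT→Parse p))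

    ParseLayer : AbsGate (ZVar n d) Carrier → (ℕ → Maybe (BTree (ZVar n d)) → Set) → Maybe (BTree (ZVar n d)) → Set
    ParseLayer (gvar z)   P r = r ≡ just (leaf z)
    ParseLayer (gcst _)   P r = r ≡ nothing
    ParseLayer (gadd ks)  P r = ∃ λ k → k ∈ ks × P k r
    ParseLayer (gmul x y) P r = ∃ λ r₁ → ∃ λ r₂ → r ≡ join r₁ r₂ × P x r₁ × P y r₂

    -- Returning the top layer rather than P b r lets the caller handle a gate not covered by P.
    parse-fold : ∀ {G} (P : ℕ → Maybe (BTree (ZVar n d)) → Set) → (∀ {b r} → ParseLayer (G b) P r → P b r) →
                 ∀ {b r} → Parse G b r → ParseLayer (G b) P r
    parse-fold P step (pvar e)      = subst (λ g → ParseLayer g P _) (sym e) refl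
    parse-fold P step (pcst e)      = subst (λ g → ParseLayer g P _) (sym e) refl
    parse-fold P step (padd e k∈ p) = subst (λ g → ParseLayer g P _) (sym e) (_ , k∈ , step (parse-fold P step p))
    parse-fold P step (pmul e p q)  =
      subst (λ g → ParseLayer g P _) (sym e) (_ , _ , refl , step (parse-fold P step p) , step (parse-fold P step q))

-- Unambiguity from positioned parse trees

labels : ∀ {A : Set} → BTree A → List A
labels (leaf a)   = a ∷ []
labels (node t u) = labels t ++ labels u

length-labels : ∀ {A : Set} (t : BTree A) → length (labels t) ≡ leafCount t
length-labels (leaf a)   = refl
length-labels (node t u) = trans (length-++ (labels t)) (cong₂ _+_ (length-labels t) (length-labels u))

depth : ∀ {A : Set} → BTree A → ℕ
depth (leaf _)   = 0
depth (node t u) = suc (depth t ⊔ depth u)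

treesUpTo : ∀ {A : Set} → List A → ℕ → List (BTree A)
treesUpTo as zero    = map leaf as
treesUpTo as (suc k) = treesUpTo as k ++ concatMap (λ t → map (node t) (treesUpTo as k)) (treesUpTo as k)

∈-treesUpTo : ∀ {A : Set} {as : List A} → (∀ a → a ∈ as) → ∀ k t → depth t ≤ k → t ∈ treesUpTo as k
∈-treesUpTo all∈ zero    (leaf a)   _ = ∈-map⁺ leaf (all∈ a)
∈-treesUpTo all∈ (suc k) (leaf a)   _ = ∈-++⁺ˡ (∈-treesUpTo all∈ k (leaf a) z≤n)
∈-treesUpTo all∈ (suc k) (node t u) (s≤s t⊔u≤k) =
  ∈-++⁺ʳ _ (∈-concatMap⁺ _ (lose (∈-treesUpTo all∈ k t (m⊔n≤o⇒m≤o _ _ t⊔u≤k))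
                                 (∈-map⁺ (node t) (∈-treesUpTo all∈ k u (m⊔n≤o⇒n≤o _ _ t⊔u≤k)))))

2^-injective : ∀ {a b} → 2 ^ a ≡ 2 ^ b → a ≡ b
2^-injective {a} {b} eq with <-cmp a b
... | tri< a<b _ _ = ⊥-elim (<-irrefl eq (^-monoʳ-< 2 (s≤s (s≤s z≤n)) a<b))
... | tri≈ _ a≡b _ = a≡b
... | tri> _ _ b<a = ⊥-elim (<-irrefl (sym eq) (^-monoʳ-< 2 (s≤s (s≤s z≤n)) b<a))

module _ {n d : ℕ} where

  position level : ZVar n d → ℕ
  position (_ , j , _) = toℕ j
  level    (_ , _ , k) = toℕ k

  Positioned : ℕ → ℕ → BTree (ZVar n d) → Set
  Positioned p l (leaf z)   = position z ≡ p × level z ≡ l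
  Positioned p l (node t u) = Positioned p (suc l) t × Positioned (p + leafCount t) (suc l) u

  positioned? : ∀ p l t → Dec (Positioned p l t)
  positioned? p l (leaf z)   = (position z ≟ℕ p) ×-dec (level z ≟ℕ l)
  positioned? p l (node t u) = positioned? p (suc l) t ×-dec positioned? (p + leafCount t) (suc l) u

  positioned-depth : ∀ {p l} t → Positioned p l t → l + depth t < d
  positioned-depth {l = l} (leaf (_ , _ , k)) (_ , refl) = subst (_< d) (sym (+-identityʳ l)) (toℕ<n k)
  positioned-depth {l = l} (node t u) (pt , pu) =
    subst (_< d) (sym (trans (+-suc l _) (cong suc (+-distribˡ-⊔ l (depth t) (depth u)))))
      (⊔-lub (positioned-depth t pt) (positioned-depth u pu))

  firstLabel : ∀ {p l} t → Positioned p l t → ∃ λ z → ∃ λ zs → labels t ≡ z ∷ zs × position z ≡ p × l ≤ level z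
  firstLabel (leaf z)   (e₁ , e₂) = z , [] , refl , e₁ , ≤-reflexive (sym e₂)
  firstLabel (node t u) (pt , _) with firstLabel t pt
  ... | z , zs , eq , pos , l<lev = z , zs ++ labels u , cong (_++ labels u) eq , pos , <⇒≤ l<lev

  positioned-position<d : ∀ {p l} t → Positioned p l t → p < d
  positioned-position<d t pt with firstLabel t pt
  ... | (_ , j , _) , _ , _ , refl , _ = toℕ<n j

  Consecutive : ℕ → List (ZVar n d) → Set
  Consecutive p []       = ⊤
  Consecutive p (z ∷ zs) = position z ≡ p × Consecutive (suc p) zs

  Consecutive-++ : ∀ p xs ys → Consecutive p xs → Consecutive (p + length xs) ys → Consecutive p (xs ++ ys)
  Consecutive-++ p []       ys _          c = subst (λ q → Consecutive q ys) (+-identityʳ p) c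
  Consecutive-++ p (x ∷ xs) ys (e , cxs) c = e , Consecutive-++ (suc p) xs ys cxs (subst (λ q → Consecutive q ys) (+-suc p (length xs)) c)

  positioned-consecutive : ∀ {p l} t → Positioned p l t → Consecutive p (labels t)
  positioned-consecutive (leaf z)   (e , _)  = e , tt
  positioned-consecutive {p} (node t u) (pt , pu) =
    Consecutive-++ p (labels t) (labels u) (positioned-consecutive t pt)
      (subst (λ q → Consecutive (p + q) (labels u)) (sym (length-labels t)) (positioned-consecutive u pu))

  Consecutive-≤ : ∀ {p xs z} → Consecutive p xs → z ∈ xs → p ≤ position z
  Consecutive-≤ (e , _) (here refl) = ≤-reflexive (sym e)
  Consecutive-≤ (_ , c) (there z∈) = <⇒≤ (Consecutive-≤ c z∈)

  -- Positions strictly increase along a consecutive list, so it is determined by its set of members.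
  consecutive-unique : ∀ {p p′} xs ys → Consecutive p xs → Consecutive p′ ys →
                       (∀ {z} → z ∈ xs → z ∈ ys) → (∀ {z} → z ∈ ys → z ∈ xs) → xs ≡ ys
  consecutive-unique []       []       _ _ _ _ = refl
  consecutive-unique []       (y ∷ ys) _ _ _ ys⊆ with () ← ys⊆ (here refl)
  consecutive-unique (x ∷ xs) []       _ _ xs⊆ _ with () ← xs⊆ (here refl)
  consecutive-unique (x ∷ xs) (y ∷ ys) cx@(ex , cxs) cy@(ey , cys) xs⊆ ys⊆
    with xs⊆ (here refl)
  ... | there x∈ys = ⊥-elim (<-irrefl (sym p≡p′) (≤-trans (Consecutive-≤ cys x∈ys) (≤-reflexive ex)))
    where
      p≡p′ = ≤-antisym (subst (_ ≤_) ey (Consecutive-≤ cx (ys⊆ (here refl))))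
                       (subst (_ ≤_) ex (Consecutive-≤ cy (xs⊆ (here refl))))
  ... | here refl = cong (x ∷_) (consecutive-unique xs ys cxs cys (drop xs⊆ ex cxs) (drop ys⊆ ey cys))
    where
      drop : ∀ {q as bs} → (∀ {z} → z ∈ x ∷ as → z ∈ x ∷ bs) → position x ≡ q → Consecutive (suc q) as →
             ∀ {z} → z ∈ as → z ∈ bs
      drop ⊆ e c z∈ with ⊆ (there z∈)
      ... | there z∈′ = z∈′
      ... | here refl = ⊥-elim (<-irrefl (sym e) (Consecutive-≤ c z∈))

  kraft : List (ZVar n d) → ℕ
  kraft []       = 0
  kraft (z ∷ zs) = 2 ^ (d ∸ level z) + kraft zs

  kraft-++ : ∀ xs ys → kraft (xs ++ ys) ≡ kraft xs + kraft ys
  kraft-++ []       ys = refl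
  kraft-++ (x ∷ xs) ys = trans (cong (2 ^ (d ∸ level x) +_) (kraft-++ xs ys)) (sym (+-assoc _ (kraft xs) (kraft ys)))

  positioned-kraft : ∀ {p l} t → Positioned p l t → kraft (labels t) ≡ 2 ^ (d ∸ l)
  positioned-kraft (leaf z)   (_ , refl) = +-identityʳ _
  positioned-kraft {l = l} (node t u) (pt , pu) = begin
    kraft (labels t ++ labels u)            ≡⟨ kraft-++ (labels t) (labels u) ⟩
    kraft (labels t) + kraft (labels u)     ≡⟨ cong₂ _+_ (positioned-kraft t pt) (positioned-kraft u pu) ⟩
    2 ^ (d ∸ suc l) + 2 ^ (d ∸ suc l)       ≡⟨ cong (2 ^ (d ∸ suc l) +_) (sym (+-identityʳ _)) ⟩
    2 ^ suc (d ∸ suc l)                     ≡⟨ cong (2 ^_) (sym (+-∸-assoc 1 l<d)) ⟩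
    2 ^ (d ∸ l)                             ∎
    where
      open ≡-Reasoning
      l<d : suc l ≤ d
      l<d = ≤-trans (s≤s (m≤m+n l (depth t))) (<⇒≤ (positioned-depth t pt))

  positioned-prefix : ∀ {p p′ l} t u xs ys → Positioned p l t → Positioned p′ l u →
                      labels t ++ xs ≡ labels u ++ ys → t ≡ u × xs ≡ ys
  positioned-prefix (leaf z) (leaf z′) xs ys _ _ eq with refl , xs≡ys ← ∷-injective eq = refl , xs≡ys
  positioned-prefix (leaf z) (node u₁ u₂) xs ys (_ , refl) (pu₁ , _) eq
    with firstLabel u₁ pu₁
  ... | _ , _ , e , _ , l<lev rewrite e with refl , _ ← ∷-injective eq = ⊥-elim (<-irrefl refl l<lev)
  positioned-prefix (node t₁ t₂) (leaf z) xs ys (pt₁ , _) (_ , refl) eq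
    with firstLabel t₁ pt₁
  ... | _ , _ , e , _ , l<lev rewrite e with refl , _ ← ∷-injective eq = ⊥-elim (<-irrefl refl l<lev)
  positioned-prefix (node t₁ t₂) (node u₁ u₂) xs ys (pt₁ , pt₂) (pu₁ , pu₂) eq
    with positioned-prefix t₁ u₁ (labels t₂ ++ xs) (labels u₂ ++ ys) pt₁ pu₁
           (trans (sym (++-assoc (labels t₁) (labels t₂) xs)) (trans eq (++-assoc (labels u₁) (labels u₂) ys)))
  ... | refl , eq₂ with positioned-prefix t₂ u₂ xs ys pt₂ pu₂ eq₂
  ... | refl , xs≡ys = refl , xs≡ys

  cvar-self : ∀ (z : ZVar n d) → let (i , j , k) = z in cvar z i j k ≡ 1
  cvar-self (i , j , k) with i ≟F i | j ≟F j | k ≟F k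
  ... | yes _   | yes _   | yes _   = refl
  ... | no  i≢i | _       | _       = ⊥-elim (i≢i refl)
  ... | yes _   | no  j≢j | _       = ⊥-elim (j≢j refl)
  ... | yes _   | yes _   | no  k≢k = ⊥-elim (k≢k refl)

  cvar-pos : ∀ (z : ZVar n d) i j k → 0 < cvar z i j k → z ≡ (i , j , k)
  cvar-pos (i , j , k) i′ j′ k′ pos with i ≟F i′ | j ≟F j′ | k ≟F k′
  ... | yes refl | yes refl | yes refl = refl
  ... | no  _    | _        | _        = ⊥-elim (<-irrefl refl pos)
  ... | yes _    | no  _    | _        = ⊥-elim (<-irrefl refl pos)
  ... | yes _    | yes _    | no  _    = ⊥-elim (<-irrefl refl pos)

  allZVars : List (ZVar n d)
  allZVars = cartesianProduct (allFin n) (cartesianProduct (allFin d) (allFin d))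

  ∈-allZVars : ∀ z → z ∈ allZVars
  ∈-allZVars (i , j , k) = ∈-cartesianProduct⁺ (∈-allFin i) (∈-cartesianProduct⁺ (∈-allFin j) (∈-allFin k))

  Candidate : Set
  Candidate = ℕ × ℕ × BTree (ZVar n d)

  candidates : List Candidate
  candidates = concatMap (λ p → concatMap (λ l → map (λ t → p , l , t) (treesUpTo allZVars d)) (upTo d)) (upTo d)

  ∈-candidates : ∀ {p l} t → Positioned p l t → (p , l , t) ∈ candidates
  ∈-candidates {p} {l} t pt =
    ∈-concatMap⁺ _ (lose (∈-upTo⁺ (positioned-position<d t pt))
      (∈-concatMap⁺ _ (lose (∈-upTo⁺ (≤-<-trans (m≤m+n l (depth t)) (positioned-depth t pt)))
        (∈-map⁺ _ (∈-treesUpTo ∈-allZVars d t (<⇒≤ (≤-<-trans (m≤n+m (depth t) l) (positioned-depth t pt))))))))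

  PositionedOrEmpty : Maybe (BTree (ZVar n d)) → Set
  PositionedOrEmpty r = r ≡ nothing ⊎ ∃ λ t → r ≡ just t × ∃ λ p → ∃ λ l → Positioned p l t

module _ {c ℓ} (F : Field c ℓ) {n d : ℕ} where
  open Poly F using (genT; gen; RPT; Unambiguous; ZCircuit)

  genT-pos⇒∈ : ∀ (t : BTree (ZVar n d)) i j k → 0 < genT t i j k → (i , j , k) ∈ labels t
  genT-pos⇒∈ (leaf z)   i j k pos = here (sym (cvar-pos z i j k pos))
  genT-pos⇒∈ (node t u) i j k pos with genT t i j k in eq
  ... | zero  = ∈-++⁺ʳ (labels t) (genT-pos⇒∈ u i j k pos)
  ... | suc _ = ∈-++⁺ˡ (genT-pos⇒∈ t i j k (subst (0 <_) (sym eq) (s≤s z≤n)))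

  ∈⇒genT-pos : ∀ (t : BTree (ZVar n d)) i j k → (i , j , k) ∈ labels t → 0 < genT t i j k
  ∈⇒genT-pos (leaf z)   i j k (here refl) = subst (0 <_) (sym (cvar-self (i , j , k))) (s≤s z≤n)
  ∈⇒genT-pos (node t u) i j k z∈ with ∈-++⁻ (labels t) z∈
  ... | inj₁ z∈t = <-≤-trans (∈⇒genT-pos t i j k z∈t) (m≤m+n _ _)
  ... | inj₂ z∈u = <-≤-trans (∈⇒genT-pos u i j k z∈u) (m≤n+m _ _)

  genT-≗⇒⊆ : ∀ (t t′ : BTree (ZVar n d)) → (∀ i j k → genT t i j k ≡ genT t′ i j k) →
             ∀ {z} → z ∈ labels t → z ∈ labels t′
  genT-≗⇒⊆ t t′ eq {i , j , k} z∈ = genT-pos⇒∈ t′ i j k (subst (0 <_) (eq i j k) (∈⇒genT-pos t i j k z∈))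

  genT-nonzero : ∀ (t : BTree (ZVar n d)) → ∃ λ i → ∃ λ j → ∃ λ k → 0 < genT t i j k
  genT-nonzero (leaf z@(i , j , k)) = i , j , k , subst (0 <_) (sym (cvar-self z)) (s≤s z≤n)
  genT-nonzero (node t u) with genT-nonzero t
  ... | i , j , k , pos = i , j , k , <-≤-trans pos (m≤m+n _ _)

  -- The monomial fixes the labels; their Kraft sum fixes l.
  positioned-unique : ∀ {p l p′ l′} t t′ → Positioned p l t → Positioned p′ l′ t′ →
                      (∀ i j k → genT t i j k ≡ genT t′ i j k) → t ≡ t′
  positioned-unique {l = l} {l′ = l′} t t′ pt pt′ eq =
    proj₁ (positioned-prefix t t′ [] [] pt (subst (λ q → Positioned _ q t′) (sym l≡l′) pt′) (cong (_++ []) labels≡))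
    where
      labels≡ : labels t ≡ labels t′
      labels≡ = consecutive-unique (labels t) (labels t′) (positioned-consecutive t pt) (positioned-consecutive t′ pt′)
                  (genT-≗⇒⊆ t t′ eq) (genT-≗⇒⊆ t′ t (λ i j k → sym (eq i j k)))
      l≤d : ∀ {p l} t → Positioned p l t → l ≤ d
      l≤d {l = l} t pt = <⇒≤ (≤-<-trans (m≤m+n l (depth t)) (positioned-depth t pt))
      l≡l′ : l ≡ l′
      l≡l′ = ∸-cancelˡ-≡ (l≤d t pt) (l≤d t′ pt′) (2^-injective
               (trans (sym (positioned-kraft t pt)) (trans (cong kraft labels≡) (positioned-kraft t′ pt′))))

  Generates : CMon n d → Candidate → Set
  Generates μ (p , l , t) = Positioned p l t × (∀ i j k → genT t i j k ≡ μ i j k)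

  generates? : ∀ μ x → Dec (Generates μ x)
  generates? μ (p , l , t) = positioned? p l t ×-dec cmon-≟ (genT t) μ

  -- Positioned trees have depth below d, so a tree generating μ can be found by search.
  decode : CMon n d → Maybe (BTree (ZVar n d))
  decode μ with any? (generates? μ) candidates
  ... | yes found = just (proj₂ (proj₂ (proj₁ (satisfied found))))
  ... | no  _     = nothing

  decode-unique : ∀ μ r → PositionedOrEmpty r → (∀ i j k → gen r i j k ≡ μ i j k) → r ≡ decode μ
  decode-unique μ r pr eq with any? (generates? μ) candidates
  decode-unique μ r (inj₁ refl) eq | yes found with satisfied found
  ... | (_ , _ , t) , _ , gen≡ with genT-nonzero t
  ... | i , j , k , pos = ⊥-elim (<-irrefl (sym (trans (gen≡ i j k) (sym (eq i j k)))) pos)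
  decode-unique μ r (inj₂ (t , refl , _ , _ , pt)) eq | yes found with satisfied found
  ... | (_ , _ , t′) , pt′ , gen≡ = cong just (positioned-unique t t′ pt pt′ λ i j k → trans (eq i j k) (sym (gen≡ i j k)))
  decode-unique μ r (inj₁ refl) eq | no _ = refl
  decode-unique μ r (inj₂ (t , refl , _ , _ , pt)) eq | no none = ⊥-elim (none (lose (∈-candidates t pt) (pt , eq)))

  unambiguous-if-positioned : ∀ {s} (Ψ : ZCircuit n d s) → (∀ g r → RPT Ψ g r → PositionedOrEmpty r) → Unambiguous Ψ
  unambiguous-if-positioned Ψ positioned μ = decode μ , λ g r p eq → decode-unique μ r (positioned g r p) eq

-- Formal sums up to permutation

module _ {c ℓ} (F : Field c ℓ) where
  open Field F using (Carrier; _≈_; 0#)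
    renaming (_+_ to _+ᶠ_; refl to ≈-refl; sym to ≈-sym; +-identityʳ to +ᶠ-identityʳ; +-identityˡ to +ᶠ-identityˡ)
  open Poly F using (coeffBy)

  pick : ∀ {p} {P : Set p} → Dec P → Carrier → Carrier
  pick (yes _) a = a
  pick (no  _) _ = 0#

  pick-yes : ∀ {p} {P : Set p} (D : Dec P) a → P → pick D a ≡ a
  pick-yes (yes _) a _  = refl
  pick-yes (no ¬p) a pf = ⊥-elim (¬p pf)

  pick-no : ∀ {p} {P : Set p} (D : Dec P) a → ¬ P → pick D a ≡ 0#
  pick-no (yes pf) a ¬p = ⊥-elim (¬p pf)
  pick-no (no _)   a _  = refl

  pick-0 : ∀ {p} {P : Set p} (D : Dec P) → pick D 0# ≡ 0#
  pick-0 (yes _) = refl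
  pick-0 (no  _) = refl

  pick-cong : ∀ {p} {P : Set p} (D : Dec P) {a b} → a ≈ b → pick D a ≈ pick D b
  pick-cong (yes _) a≈b = a≈b
  pick-cong (no  _) _   = ≈-refl

  pick-+ : ∀ {p} {P : Set p} (D : Dec P) a b → pick D (a +ᶠ b) ≈ pick D a +ᶠ pick D b
  pick-+ (yes _) a b = ≈-refl
  pick-+ (no  _) a b = ≈-sym (+ᶠ-identityʳ 0#)

  coeffBy-∷ : ∀ {M : Set} {R : M → M → Set} (eq? : ∀ m m′ → Dec (R m m′)) a m p μ →
              coeffBy eq? ((a , m) ∷ p) μ ≈ pick (eq? m μ) a +ᶠ coeffBy eq? p μ
  coeffBy-∷ eq? a m p μ with eq? m μ
  ... | yes _ = ≈-refl
  ... | no  _ = ≈-sym (+ᶠ-identityˡ _)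

module FormalSums {c ℓ} (F : Field c ℓ) {n d : ℕ} where
  open Field F using (Carrier; _≈_; *-cong; +-cong; setoid; +-isCommutativeMonoid)
    renaming (_*_ to _*ᶠ_; refl to ≈-refl; sym to ≈-sym; trans to ≈-trans)
  open Poly F

  Entry : Set c
  Entry = Carrier × CMon n d

  _≗C_ : CMon n d → CMon n d → Set
  μ ≗C ν = ∀ i j k → μ i j k ≡ ν i j k

  _≈E_ : Entry → Entry → Set ℓ
  (a , μ) ≈E (b , ν) = a ≈ b × μ ≗C ν

  entrySetoid : Setoid c ℓ
  entrySetoid = record
    { Carrier       = Entry
    ; _≈_           = _≈E_
    ; isEquivalence = record
      { refl  = ≈-refl , λ i j k → refl
      ; sym   = λ (a≈b , μ≗ν) → ≈-sym a≈b , λ i j k → sym (μ≗ν i j k)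
      ; trans = λ (a≈b , μ≗ν) (b≈c , ν≗ρ) → ≈-trans a≈b b≈c , λ i j k → trans (μ≗ν i j k) (ν≗ρ i j k)
      }
    }

  open Permutation entrySetoid public using (_↭_; prep; ↭-refl; ↭-reflexive; ↭-sym; ↭-trans; module PermutationReasoning)
  open PermutationProperties entrySetoid public using (++⁺; ++⁺ˡ; shifts)

  map-↭ : ∀ {A : Set c} (f g : A → Entry) xs → (∀ x → x ∈ xs → f x ≈E g x) → map f xs ↭ map g xs
  map-↭ f g []       f≈g = ↭-refl
  map-↭ f g (x ∷ xs) f≈g = prep (f≈g x (here refl)) (map-↭ f g xs λ y y∈ → f≈g y (there y∈))

  concatMap-↭ : ∀ {a} {A : Set a} (f g : A → List Entry) xs → (∀ x → x ∈ xs → f x ↭ g x) →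
                concatMap f xs ↭ concatMap g xs
  concatMap-↭ f g []       f↭g = ↭-refl
  concatMap-↭ f g (x ∷ xs) f↭g = ++⁺ (f↭g x (here refl)) (concatMap-↭ f g xs λ y y∈ → f↭g y (there y∈))

  concatMap⁺ : ∀ (f : Entry → List Entry) → (∀ {x y} → x ≈E y → f x ↭ f y) →
               ∀ {xs ys} → xs ↭ ys → concatMap f xs ↭ concatMap f ys
  concatMap⁺ f f-cong (Permutation.refl []) = ↭-refl
  concatMap⁺ f f-cong (Permutation.refl (x≈y ∷ xs≋ys)) = ++⁺ (f-cong x≈y) (concatMap⁺ f f-cong (Permutation.refl xs≋ys))
  concatMap⁺ f f-cong (prep x≈y p) = ++⁺ (f-cong x≈y) (concatMap⁺ f f-cong p)
  concatMap⁺ f f-cong (Permutation.swap {x = x} {y} {x′} {y′} x≈x′ y≈y′ p) =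
    ↭-trans (shifts (f x) (f y)) (++⁺ (f-cong y≈y′) (++⁺ (f-cong x≈x′) (concatMap⁺ f f-cong p)))
  concatMap⁺ f f-cong (Permutation.trans p q) = ↭-trans (concatMap⁺ f f-cong p) (concatMap⁺ f f-cong q)

  mulE : Entry → Entry → Entry
  mulE (a , μ) (b , ν) = a *ᶠ b , μ ⊕ ν

  mulE-cong : ∀ {x x′ y y′} → x ≈E x′ → y ≈E y′ → mulE x y ≈E mulE x′ y′
  mulE-cong (a≈ , μ≗) (b≈ , ν≗) = *-cong a≈ b≈ , λ i j k → cong₂ _+_ (μ≗ i j k) (ν≗ i j k)

  mulBy-↭ : ∀ {A A′ B B′} → A ↭ A′ → B ↭ B′ → mulBy _⊕_ A B ↭ mulBy _⊕_ A′ B′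
  mulBy-↭ {A′ = A′} {B} {B′} A↭A′ B↭B′ = ↭-trans
    (concatMap⁺ (λ x → map (mulE x) B) (λ x≈y → map-↭ _ _ B λ z _ → mulE-cong x≈y (Setoid.refl entrySetoid)) A↭A′)
    (concatMap-↭ _ _ A′ λ x _ → PermutationProperties.map⁺ entrySetoid entrySetoid (mulE-cong (Setoid.refl entrySetoid)) B↭B′)

  contribution : CMon n d → Entry → Carrier
  contribution μ (a , ν) = pick F (cmon-≟ ν μ) a

  contribution-cong : ∀ μ {x y} → x ≈E y → contribution μ x ≈ contribution μ y
  contribution-cong μ {a , ν} {b , ν′} (a≈b , ν≗ν′) with cmon-≟ ν μ | cmon-≟ ν′ μ
  ... | yes _   | yes _    = a≈b
  ... | no  _   | no  _    = ≈-refl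
  ... | yes ν≗μ | no  ν′≉μ = ⊥-elim (ν′≉μ λ i j k → trans (sym (ν≗ν′ i j k)) (ν≗μ i j k))
  ... | no  ν≉μ | yes ν′≗μ = ⊥-elim (ν≉μ λ i j k → trans (ν≗ν′ i j k) (ν′≗μ i j k))

  zcoeff-sum : ∀ xs μ → zcoeff xs μ ≈ sumC (map (contribution μ) xs)
  zcoeff-sum []             μ = ≈-refl
  zcoeff-sum ((a , ν) ∷ xs) μ = ≈-trans (coeffBy-∷ F cmon-≟ a ν xs μ) (+-cong ≈-refl (zcoeff-sum xs μ))

  -- Coefficients are sums, and sums in a commutative monoid are invariant under permutation.
  zcoeff-↭ : ∀ {xs ys} → xs ↭ ys → ∀ μ → zcoeff xs μ ≈ zcoeff ys μ
  zcoeff-↭ {xs} {ys} xs↭ys μ = ≈-trans (zcoeff-sum xs μ) (≈-trans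
    (PermutationProperties.foldr-commMonoid setoid +-isCommutativeMonoid
       (PermutationProperties.map⁺ entrySetoid setoid (contribution-cong μ) xs↭ys))
    (≈-sym (zcoeff-sum ys μ)))

-- Placing monomials at a position and level

leafExponent : ∀ {n d} → Maybe (Fin n × ℕ) → Fin n → Fin d → ℕ
leafExponent nothing        i k = 0
leafExponent (just (a , l)) i k = if does (a ≟F i) ∧ does (l ≟ℕ suc (toℕ k)) then 1 else 0

-- lookupFrom xs p q is the element with index q when the head of xs has index p.
lookupFrom : ∀ {A : Set} → List A → ℕ → ℕ → Maybe A
lookupFrom []       p q = nothing
lookupFrom (x ∷ xs) p q with q ≟ℕ p
... | yes _ = just x
... | no  _ = lookupFrom xs (suc p) q

lookupFrom-below : ∀ {A : Set} (xs : List A) p q → q < p → lookupFrom xs p q ≡ nothing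
lookupFrom-below []       p q q<p = refl
lookupFrom-below (x ∷ xs) p q q<p with q ≟ℕ p
... | yes refl = ⊥-elim (<-irrefl refl q<p)
... | no  _    = lookupFrom-below xs (suc p) q (m<n⇒m<1+n q<p)

lookupFrom-suc : ∀ {A : Set} (xs : List A) p q → lookupFrom xs (suc p) (suc q) ≡ lookupFrom xs p q
lookupFrom-suc []       p q = refl
lookupFrom-suc (x ∷ xs) p q with q ≟ℕ p | suc q ≟ℕ suc p
... | yes _    | yes _   = refl
... | no  _    | no  _   = lookupFrom-suc xs (suc p) q
... | yes refl | no  q≢q = ⊥-elim (q≢q refl)
... | no  q≢p  | yes refl = ⊥-elim (q≢p refl)

leafExponent-++ : ∀ {n d} (xs ys : List (Fin n × ℕ)) p q (i : Fin n) (k : Fin d) →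
  leafExponent (lookupFrom (xs ++ ys) p q) i k ≡ leafExponent (lookupFrom xs p q) i k + leafExponent (lookupFrom ys (p + length xs) q) i k
leafExponent-++ []       ys p q i k = cong (λ r → leafExponent (lookupFrom ys r q) i k) (sym (+-identityʳ p))
leafExponent-++ (x ∷ xs) ys p q i k with q ≟ℕ p
... | yes refl = trans (sym (+-identityʳ _)) (cong (λ r → leafExponent (just x) i k + leafExponent r i k)
                   (sym (lookupFrom-below ys _ q (m<m+n q (s≤s z≤n)))))
... | no  _    = trans (leafExponent-++ xs ys (suc p) q i k)
                   (cong (λ r → leafExponent (lookupFrom xs (suc p) q) i k + leafExponent (lookupFrom ys r q) i k) (sym (+-suc p (length xs))))

leafCount≥1 : ∀ {A : Set} (t : BTree A) → 1 ≤ leafCount t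
leafCount≥1 (leaf _)   = ≤-refl
leafCount≥1 (node t u) = ≤-trans (leafCount≥1 t) (m≤m+n _ _)

deg-⊗ : ∀ {n} (m m′ : NMon n) → deg (m ⊗ m′) ≡ deg m + deg m′
deg-⊗ one      m′       = refl
deg-⊗ (tree t) one      = sym (+-identityʳ _)
deg-⊗ (tree t) (tree u) = refl

deg≡0⇒one : ∀ {n} (m : NMon n) → deg m ≡ 0 → m ≡ one
deg≡0⇒one one      _  = refl
deg≡0⇒one (tree t) eq = ⊥-elim (<-irrefl (sym eq) (leafCount≥1 t))

-- A slot (p , l , e) asks for the degree-e part of a polynomial, placed so that the
-- leaves of its monomials get the positions p, p+1, ... and the roots lie at level index l.
Slot : Set
Slot = ℕ × ℕ × ℕ

slotDegree : Slot → ℕ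
slotDegree (_ , _ , e) = e

-- The slots of the factors when the left factor has degree e₁.  A factor of degree 0 is the
-- monomial one, which the product absorbs without a new node; the other factor keeps the slot.
leftSlot : Slot → ℕ → Slot
leftSlot (p , l , e) zero = 0 , 0 , 0
leftSlot (p , l , e) (suc w) with suc w ≟ℕ e
... | yes _ = p , l , e
... | no  _ = p , suc l , suc w

rightSlot : Slot → ℕ → Slot
rightSlot (p , l , e) zero = p , l , e
rightSlot (p , l , e) (suc w) with suc w ≟ℕ e
... | yes _ = 0 , 0 , 0
... | no  _ = p + suc w , suc l , e ∸ suc w

slotDegree-leftSlot : ∀ p l e e₁ → slotDegree (leftSlot (p , l , e) e₁) ≡ e₁
slotDegree-leftSlot p l e zero = refl
slotDegree-leftSlot p l e (suc w) with suc w ≟ℕ e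
... | yes refl = refl
... | no  _    = refl

slotDegree-rightSlot : ∀ p l e e₁ → slotDegree (rightSlot (p , l , e) e₁) ≡ e ∸ e₁
slotDegree-rightSlot p l e zero = refl
slotDegree-rightSlot p l e (suc w) with suc w ≟ℕ e
... | yes refl = sym (n∸n≡0 w)
... | no  _    = refl

module Placement {c ℓ} (F : Field c ℓ) {n d : ℕ} where
  open Poly F
  open Field F using (Carrier) renaming (_*_ to _*ᶠ_; refl to ≈-refl)
  open FormalSums F {n} {d}

  lookupFrom-zero : ∀ {A : Set} (xs : List A) q → lookupFrom xs 0 q ≡ lookupL xs q
  lookupFrom-zero []       q       = refl
  lookupFrom-zero (x ∷ xs) zero    = refl
  lookupFrom-zero (x ∷ xs) (suc q) = trans (lookupFrom-suc xs 0 q) (lookupFrom-zero xs q)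

  φmonAtT : ℕ → ℕ → BTree (Fin n) → CMon n d
  φmonAtT p l (leaf x) i j k with toℕ j ≟ℕ p
  ... | yes _ = leafExponent (just (x , suc l)) i k
  ... | no  _ = 0
  φmonAtT p l (node t u) = φmonAtT p (suc l) t ⊕ φmonAtT (p + leafCount t) (suc l) u

  φmonAt : ℕ → ℕ → NMon n → CMon n d
  φmonAt p l one      = cone
  φmonAt p l (tree t) = φmonAtT p l t

  length-leavesAt : ∀ l (t : BTree (Fin n)) → length (leavesAt l t) ≡ leafCount t
  length-leavesAt l (leaf x)   = refl
  length-leavesAt l (node t u) = trans (length-++ (leavesAt (suc l) t))
                                       (cong₂ _+_ (length-leavesAt (suc l) t) (length-leavesAt (suc l) u))

  φmonAtT-lookup : ∀ p l (t : BTree (Fin n)) i j k →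
                   φmonAtT p l t i j k ≡ leafExponent (lookupFrom (leavesAt (suc l) t) p (toℕ j)) i k
  φmonAtT-lookup p l (leaf x) i j k with toℕ j ≟ℕ p
  ... | yes _ = refl
  ... | no  _ = refl
  φmonAtT-lookup p l (node t u) i j k = begin
    φmonAtT p (suc l) t i j k + φmonAtT (p + leafCount t) (suc l) u i j k
      ≡⟨ cong₂ _+_ (φmonAtT-lookup p (suc l) t i j k) (φmonAtT-lookup (p + leafCount t) (suc l) u i j k) ⟩
    leafExponent (lookupFrom ts p (toℕ j)) i k + leafExponent (lookupFrom us (p + leafCount t) (toℕ j)) i k
      ≡⟨ cong (λ q → leafExponent (lookupFrom ts p (toℕ j)) i k + leafExponent (lookupFrom us (p + q) (toℕ j)) i k)
              (sym (length-leavesAt (suc (suc l)) t)) ⟩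
    leafExponent (lookupFrom ts p (toℕ j)) i k + leafExponent (lookupFrom us (p + length ts) (toℕ j)) i k
      ≡⟨ sym (leafExponent-++ ts us p (toℕ j) i k) ⟩
    leafExponent (lookupFrom (ts ++ us) p (toℕ j)) i k ∎
    where
      open ≡-Reasoning
      ts = leavesAt (suc (suc l)) t
      us = leavesAt (suc (suc l)) u

  φmon-φmonAt : ∀ (m : NMon n) i j k → φmon m i j k ≡ φmonAt 0 0 m i j k
  φmon-φmonAt one      i j k = refl
  φmon-φmonAt (tree t) i j k = begin
    φmon (tree t) i j k                                            ≡⟨ φmon≡leafExponent ⟩
    leafExponent (lookupL (leavesAt 1 t) (toℕ j)) i k
      ≡⟨ cong (λ r → leafExponent r i k) (sym (lookupFrom-zero (leavesAt 1 t) (toℕ j))) ⟩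
    leafExponent (lookupFrom (leavesAt 1 t) 0 (toℕ j)) i k         ≡⟨ sym (φmonAtT-lookup 0 0 t i j k) ⟩
    φmonAtT 0 0 t i j k                                            ∎
    where
      open ≡-Reasoning
      φmon≡leafExponent : φmon (tree t) i j k ≡ leafExponent (lookupL (leavesAt 1 t) (toℕ j)) i k
      φmon≡leafExponent with lookupL (leavesAt 1 t) (toℕ j)
      ... | nothing = refl
      ... | just _  = refl

  cvar-φmonAtT : ∀ x (j₀ k₀ : Fin d) → ∀ i j k → cvar (x , j₀ , k₀) i j k ≡ φmonAtT (toℕ j₀) (toℕ k₀) (leaf x) i j k
  cvar-φmonAtT x j₀ k₀ i j k with toℕ j ≟ℕ toℕ j₀ | j₀ ≟F j
  ... | no  j≢j₀ | yes refl = ⊥-elim (j≢j₀ refl)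
  ... | yes j≡j₀ | no j₀≢j  = ⊥-elim (j₀≢j (toℕ-injective (sym j≡j₀)))
  ... | no  _    | no _ with x ≟F i
  ...   | yes _ = refl
  ...   | no  _ = refl
  cvar-φmonAtT x j₀ k₀ i j k | yes _ | yes refl with x ≟F i
  ...   | no  _ = refl
  ...   | yes _ with k₀ ≟F k | toℕ k₀ ≡ᵇ toℕ k in eq
  ...     | yes refl | true  = refl
  ...     | no  _    | false = refl
  ...     | yes refl | false = ⊥-elim (subst Bool.T eq (≡⇒≡ᵇ (toℕ k₀) (toℕ k₀) refl))
  ...     | no  k₀≢k | true  = ⊥-elim (k₀≢k (toℕ-injective (≡ᵇ⇒≡ (toℕ k₀) (toℕ k) (subst Bool.T (sym eq) _))))

  NEntry : Set c
  NEntry = Carrier × NMon n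

  mulN : NEntry → NEntry → NEntry
  mulN (a , m) (b , m′) = a *ᶠ b , m ⊗ m′

  homog-++ : ∀ e (xs ys : NPoly n) → homog e (xs ++ ys) ≡ homog e xs ++ homog e ys
  homog-++ e []             ys = refl
  homog-++ e ((a , m) ∷ xs) ys with deg m ≟ℕ e
  ... | yes _ = cong ((a , m) ∷_) (homog-++ e xs ys)
  ... | no  _ = homog-++ e xs ys

  ∈-homog⇒deg : ∀ e (xs : NPoly n) {x} → x ∈ homog e xs → deg (proj₂ x) ≡ e
  ∈-homog⇒deg e ((a , m) ∷ xs) x∈ with deg m ≟ℕ e
  ∈-homog⇒deg e ((a , m) ∷ xs) (here refl) | yes deg≡e = deg≡e
  ∈-homog⇒deg e ((a , m) ∷ xs) (there x∈)  | yes _     = ∈-homog⇒deg e xs x∈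
  ... | no _ = ∈-homog⇒deg e xs x∈

  homog-mulN-≤ : ∀ e x (B : NPoly n) → deg (proj₂ x) ≤ e →
                 homog e (map (mulN x) B) ≡ map (mulN x) (homog (e ∸ deg (proj₂ x)) B)
  homog-mulN-≤ e x       []              _ = refl
  homog-mulN-≤ e x@(a , m) ((b , m′) ∷ B) m≤e with deg (m ⊗ m′) ≟ℕ e | deg m′ ≟ℕ (e ∸ deg m)
  ... | yes _  | yes _  = cong (mulN x (b , m′) ∷_) (homog-mulN-≤ e x B m≤e)
  ... | no  _  | no  _  = homog-mulN-≤ e x B m≤e
  ... | yes eq | no  ne = ⊥-elim (ne (trans (sym (m+n∸m≡n (deg m) (deg m′))) (cong (_∸ deg m) (trans (sym (deg-⊗ m m′)) eq))))
  ... | no  ne | yes eq = ⊥-elim (ne (trans (deg-⊗ m m′) (trans (cong (deg m +_) eq) (m+[n∸m]≡n m≤e))))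

  homog-mulN-> : ∀ e x (B : NPoly n) → e < deg (proj₂ x) → homog e (map (mulN x) B) ≡ []
  homog-mulN-> e x       []              _ = refl
  homog-mulN-> e x@(a , m) ((b , m′) ∷ B) e<m with deg (m ⊗ m′) ≟ℕ e
  ... | yes eq = ⊥-elim (<-irrefl refl (<-≤-trans e<m (≤-trans (m≤m+n (deg m) (deg m′)) (≤-reflexive (trans (sym (deg-⊗ m m′)) eq)))))
  ... | no  _  = homog-mulN-> e x B e<m

  φmonAtSlot : Slot → NMon n → CMon n d
  φmonAtSlot (p , l , _) = φmonAt p l

  placeE : Slot → NEntry → Entry
  placeE s (a , m) = a , φmonAtSlot s m

  Target : Slot → NPoly n → ZPoly n d
  Target s X = map (placeE s) (homog (slotDegree s) X)

  Target-++ : ∀ s (xs ys : NPoly n) → Target s (xs ++ ys) ≡ Target s xs ++ Target s ys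
  Target-++ s xs ys = trans (cong (map (placeE s)) (homog-++ (slotDegree s) xs ys)) (map-++ (placeE s) (homog (slotDegree s) xs) (homog (slotDegree s) ys))

  Target-concatMap : ∀ {a} {A : Set a} s (f : A → NPoly n) xs → Target s (concatMap f xs) ≡ concatMap (Target s ∘ f) xs
  Target-concatMap s f []       = refl
  Target-concatMap s f (x ∷ xs) = trans (Target-++ s (f x) (concatMap f xs)) (cong (Target s (f x) ++_) (Target-concatMap s f xs))

  φmonAt-⊗ : ∀ p l e e₁ (m m′ : NMon n) → e₁ ≤ e → deg m ≡ e₁ → deg m′ ≡ e ∸ e₁ →
             φmonAt p l (m ⊗ m′) ≗C (φmonAtSlot (leftSlot (p , l , e) e₁) m ⊕ φmonAtSlot (rightSlot (p , l , e) e₁) m′)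
  φmonAt-⊗ p l e zero m m′ _ deg-m _ i j k with deg≡0⇒one m deg-m
  ... | refl = refl
  φmonAt-⊗ p l e (suc w) (tree t) m′ e₁≤e deg-t deg-m′ i j k with suc w ≟ℕ e
  ... | yes refl with deg≡0⇒one m′ (trans deg-m′ (n∸n≡0 (suc w)))
  ...   | refl = sym (+-identityʳ _)
  φmonAt-⊗ p l e (suc w) (tree t) one e₁≤e deg-t deg-m′ i j k | no e₁≢e =
    ⊥-elim (e₁≢e (≤-antisym e₁≤e (m∸n≡0⇒m≤n (sym deg-m′))))
  φmonAt-⊗ p l e (suc w) (tree t) (tree u) e₁≤e deg-t deg-m′ i j k | no _ =
    cong (λ q → φmonAtT p (suc l) t i j k + φmonAtT (p + q) (suc l) u i j k) deg-t

  byDegree : (NEntry → List Entry) → ℕ → NPoly n → List Entry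
  byDegree f k A = concatMap (λ e₁ → concatMap f (homog e₁ A)) (downFrom k)

  byDegree-[] : ∀ f k → byDegree f k [] ≡ []
  byDegree-[] f zero    = refl
  byDegree-[] f (suc k) = byDegree-[] f k

  byDegree-skip : ∀ f k x A → k ≤ deg (proj₂ x) → byDegree f k (x ∷ A) ≡ byDegree f k A
  byDegree-skip f zero    x       A _   = refl
  byDegree-skip f (suc k) (a , m) A k<m with deg m ≟ℕ k
  ... | yes m≡k = ⊥-elim (<-irrefl (sym m≡k) k<m)
  ... | no  _   = cong (concatMap f (homog k A) ++_) (byDegree-skip f k (a , m) A (<⇒≤ k<m))

  byDegree-cons : ∀ f k x A → deg (proj₂ x) < k → byDegree f k (x ∷ A) ↭ f x ++ byDegree f k A
  byDegree-cons f (suc k) x@(a , m) A m<1+k with deg m ≟ℕ k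
  ... | yes m≡k = ↭-reflexive (begin
      (f x ++ concatMap f (homog k A)) ++ byDegree f k (x ∷ A)
        ≡⟨ cong ((f x ++ concatMap f (homog k A)) ++_) (byDegree-skip f k x A (≤-reflexive (sym m≡k))) ⟩
      (f x ++ concatMap f (homog k A)) ++ byDegree f k A
        ≡⟨ ++-assoc (f x) _ _ ⟩
      f x ++ byDegree f (suc k) A ∎)
    where open ≡-Reasoning
  ... | no  m≢k = ↭-trans (++⁺ˡ (concatMap f (homog k A)) (byDegree-cons f k x A (≤∧≢⇒< (≤-pred m<1+k) m≢k)))
                          (shifts (concatMap f (homog k A)) (f x))

  regroup-by-degree : ∀ (f : NEntry → List Entry) e → (∀ x → e < deg (proj₂ x) → f x ≡ []) →
                      ∀ A → concatMap f A ↭ byDegree f (suc e) A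
  regroup-by-degree f e vanish []      = ↭-reflexive (sym (byDegree-[] f (suc e)))
  regroup-by-degree f e vanish (x ∷ A) with ≤-<-connex (deg (proj₂ x)) e
  ... | inj₁ x≤e = ↭-trans (++⁺ˡ (f x) (regroup-by-degree f e vanish A)) (↭-sym (byDegree-cons f (suc e) x A (s≤s x≤e)))
  ... | inj₂ e<x = ↭-trans (↭-reflexive (cong (_++ concatMap f A) (vanish x e<x)))
                     (↭-trans (regroup-by-degree f e vanish A) (↭-reflexive (sym (byDegree-skip f (suc e) x A e<x))))

  Target-summand : ∀ p l e e₁ sL sR (A B : NPoly n) → e₁ ≤ e → slotDegree sL ≡ e₁ → slotDegree sR ≡ e ∸ e₁ →
    (∀ m m′ → deg m ≡ e₁ → deg m′ ≡ e ∸ e₁ → φmonAt p l (m ⊗ m′) ≗C (φmonAtSlot sL m ⊕ φmonAtSlot sR m′)) →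
    concatMap (λ x → Target (p , l , e) (map (mulN x) B)) (homog e₁ A) ↭ mulBy _⊕_ (Target sL A) (Target sR B)
  Target-summand p l e e₁ sL@(_ , _ , _) sR@(_ , _ , _) A B e₁≤e refl refl φ-⊗ =
    ↭-trans (concatMap-↭ _ _ (homog e₁ A) summand)
            (↭-reflexive (sym (concatMap-map (λ y → map (mulE y) (Target sR B)) (placeE sL) (homog e₁ A))))
    where
      summand : ∀ x → x ∈ homog e₁ A →
                Target (p , l , e) (map (mulN x) B) ↭ map (mulE (placeE sL x)) (Target sR B)
      summand x x∈ = begin
        map (placeE (p , l , e)) (homog e (map (mulN x) B))
          ≡⟨ cong (map (placeE (p , l , e))) (trans (homog-mulN-≤ e x B (≤-trans (≤-reflexive deg-x) e₁≤e))
                                                    (cong (λ q → map (mulN x) (homog (e ∸ q) B)) deg-x)) ⟩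
        map (placeE (p , l , e)) (map (mulN x) (homog (e ∸ e₁) B))
          ≡⟨ sym (map-∘ (homog (e ∸ e₁) B)) ⟩
        map (placeE (p , l , e) ∘ mulN x) (homog (e ∸ e₁) B)
          ↭⟨ map-↭ _ _ (homog (e ∸ e₁) B) (λ y y∈ → ≈-refl , φ-⊗ (proj₂ x) (proj₂ y) deg-x (∈-homog⇒deg (e ∸ e₁) B y∈)) ⟩
        map (mulE (placeE sL x) ∘ placeE sR) (homog (e ∸ e₁) B)
          ≡⟨ map-∘ (homog (e ∸ e₁) B) ⟩
        map (mulE (placeE sL x)) (Target sR B) ∎
        where
          open PermutationReasoning
          deg-x = ∈-homog⇒deg e₁ A x∈

  Target-mulBy : ∀ p l e (A B : NPoly n) → Target (p , l , e) (mulBy _⊗_ A B) ↭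
    concatMap (λ e₁ → mulBy _⊕_ (Target (leftSlot (p , l , e) e₁) A) (Target (rightSlot (p , l , e) e₁) B)) (downFrom (suc e))
  Target-mulBy p l e A B =
    ↭-trans (↭-reflexive (Target-concatMap (p , l , e) (λ x → map (mulN x) B) A))
      (↭-trans (regroup-by-degree _ e (λ x e<x → cong (map (placeE (p , l , e))) (homog-mulN-> e x B e<x)) A)
        (concatMap-↭ _ _ (downFrom (suc e)) λ e₁ e₁∈ →
           let e₁≤e = ≤-pred (∈-downFrom⁻ e₁∈) in
           Target-summand p l e e₁ _ _ A B e₁≤e (slotDegree-leftSlot p l e e₁) (slotDegree-rightSlot p l e e₁)
             (λ m m′ deg-m deg-m′ → φmonAt-⊗ p l e e₁ m m′ e₁≤e deg-m deg-m′)))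

  Target-origin : ∀ e (X : NPoly n) → Target (0 , 0 , e) X ↭ φ (homog e X)
  Target-origin e X = map-↭ _ _ (homog e X) λ (_ , m) _ → ≈-refl , λ i j k → sym (φmon-φmonAt m i j k)

-- The slot circuit

divmod-unique : ∀ q k m .{{_ : NonZero m}} → q < m → (q + k * m) / m ≡ k × (q + k * m) % m ≡ q
divmod-unique q k m q<m = quotient , remainder
  where
    remainder : (q + k * m) % m ≡ q
    remainder = trans ([m+kn]%n≡m%n q k m) (m<n⇒m%n≡m q<m)
    quotient : (q + k * m) / m ≡ k
    quotient = sym (*-cancelʳ-≡ k ((q + k * m) / m) m
                 (+-cancelˡ-≡ q (k * m) ((q + k * m) / m * m)
                   (trans (m≡m%n+[m/n]*n (q + k * m) m) (cong (_+ ((q + k * m) / m * m)) remainder))))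

mixedRadix< : ∀ {a b m k} → a < m → b < k → a + b * m < k * m
mixedRadix< {b = b} {m} a<m b<k = <-≤-trans (+-monoˡ-< (b * m) a<m) (*-monoˡ-≤ m b<k)

-- Writing d = 2 + x, 3 d⁴ exceeds (d³ + 1)(d + 2) + 1 by a polynomial in x with nonnegative coefficients.
blockSize-bound : ∀ d → 2 ≤ d → suc (suc (d * d * d) * suc (suc d)) ≤ 3 * d ^ 4
blockSize-bound (suc zero)    (s≤s ())
blockSize-bound (suc (suc x)) _ = ≤-trans (m≤m+n _ _) (≤-reflexive (sym (identity x)))
  where
    open +-*-Solver
    identity : ∀ x → 3 * (2 + x) ^ 4 ≡ 1 + (1 + (2 + x) * (2 + x) * (2 + x)) * (2 + (2 + x)) + (2 * x ^ 4 + 14 * x ^ 3 + 36 * x ^ 2 + 39 * x + 11)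
    identity = solve 1 (λ x → con 3 :* (con 2 :+ x) :^ 4 :=
                 con 1 :+ (con 1 :+ (con 2 :+ x) :* (con 2 :+ x) :* (con 2 :+ x)) :* (con 2 :+ (con 2 :+ x))
                 :+ (con 2 :* x :^ 4 :+ con 14 :* x :^ 3 :+ con 36 :* x :^ 2 :+ con 39 :* x :+ con 11)) refl

-- Gate v of the original circuit becomes the block of gates code v τ w, one for each slot
-- code τ ≤ T and each w < W: w = suc d is the gate computing the slot, and w ≤ d is the
-- product summand whose left factor has degree w.  Slot codes below T encode the slots of
-- positive degree, T encodes the slot (0 , 0 , 0).
module SlotEncoding (d : ℕ) .{{_ : NonZero d}} where

  T W K : ℕ
  T = d * d * d
  W = suc (suc d)
  K = suc T * W

  code : ℕ → ℕ → ℕ → ℕ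
  code v τ w = w + τ * W + v * K

  slotOf : ℕ → Slot
  slotOf τ with τ <? T
  ... | yes _ = τ % d , (τ / d) % d , suc ((τ / d) / d)
  ... | no  _ = 0 , 0 , 0

  slotCode : Slot → ℕ
  slotCode (p , l , zero)    = T
  slotCode (p , l , suc e-1) = p + (l + e-1 * d) * d

  InRange : Slot → Set
  InRange (p , l , e) = p + e ≤ d × l + e ≤ d

  inRange? : ∀ σ → Dec (InRange σ)
  inRange? (p , l , e) = (p + e ≤? d) ×-dec (l + e ≤? d)

  -- slotCode sends every slot of degree 0 to T, which decodes to (0 , 0 , 0).
  Valid : Slot → Set
  Valid (p , l , e) = InRange (p , l , e) × (e ≡ 0 → p ≡ 0 × l ≡ 0)

  slotAndSub<K : ∀ τ w → τ ≤ T → w < W → w + τ * W < K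
  slotAndSub<K τ w τ≤T w<W = mixedRadix< w<W (s≤s τ≤T)

  code-decode : ∀ v τ w → τ ≤ T → w < W →
                code v τ w / K ≡ v × (code v τ w % K) / W ≡ τ × (code v τ w % K) % W ≡ w
  code-decode v τ w τ≤T w<W with divmod-unique (w + τ * W) v K (slotAndSub<K τ w τ≤T w<W)
  ... | v≡ , rest≡ rewrite rest≡ = v≡ , divmod-unique w τ W w<W

  code-surjective : ∀ b → b ≡ code (b / K) ((b % K) / W) ((b % K) % W)
  code-surjective b = trans (m≡m%n+[m/n]*n b K) (cong (_+ (b / K) * K) (m≡m%n+[m/n]*n (b % K) W))

  slotPart≤T : ∀ b → (b % K) / W ≤ T
  slotPart≤T b = ≤-pred (m<n*o⇒m/o<n (m%n<n b K))

  code<S*K : ∀ {S} v τ w → v < S → τ ≤ T → w < W → code v τ w < S * K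
  code<S*K v τ w v<S τ≤T w<W = mixedRadix< (slotAndSub<K τ w τ≤T w<W) v<S

  code-<-gate : ∀ {c v τ₁ w₁} τ w → c < v → τ₁ ≤ T → w₁ < W → code c τ₁ w₁ < code v τ w
  code-<-gate {c} {v} {τ₁} {w₁} τ w c<v τ₁≤T w₁<W =
    <-≤-trans (mixedRadix< (slotAndSub<K τ₁ w₁ τ₁≤T w₁<W) c<v) (m≤n+m (v * K) (w + τ * W))

  code-<-sub : ∀ v τ {w₁ w} → w₁ < w → code v τ w₁ < code v τ w
  code-<-sub v τ w₁<w = +-monoˡ-< (v * K) (+-monoˡ-< (τ * W) w₁<w)

  slotOf-T : slotOf T ≡ (0 , 0 , 0)
  slotOf-T with T <? T
  ... | yes T<T = ⊥-elim (<-irrefl refl T<T)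
  ... | no  _   = refl

  slotOf-valid : ∀ τ → InRange (slotOf τ) → Valid (slotOf τ)
  slotOf-valid τ inRange with τ <? T
  ... | yes _ = inRange , λ ()
  ... | no  _ = inRange , λ _ → refl , refl

  slotCode-valid : ∀ σ → Valid σ → slotCode σ ≤ T × slotOf (slotCode σ) ≡ σ
  slotCode-valid (p , l , zero) (_ , at0) with at0 refl
  ... | refl , refl = ≤-refl , slotOf-T
  slotCode-valid (p , l , suc e-1) ((p+e≤d , l+e≤d) , _) = <⇒≤ code<T , slotOf-code
    where
      p<d : p < d
      p<d = <-≤-trans (m<m+n p (s≤s z≤n)) p+e≤d
      l<d : l < d
      l<d = <-≤-trans (m<m+n l (s≤s z≤n)) l+e≤d
      e-1<d : e-1 < d
      e-1<d = <-≤-trans (s≤s (m≤n+m e-1 l)) (≤-trans (≤-reflexive (sym (+-suc l e-1))) l+e≤d)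
      code<T : p + (l + e-1 * d) * d < T
      code<T = mixedRadix< p<d (mixedRadix< l<d e-1<d)
      slotOf-code : slotOf (p + (l + e-1 * d) * d) ≡ (p , l , suc e-1)
      slotOf-code with p + (l + e-1 * d) * d <? T
      ... | no  ¬code<T = ⊥-elim (¬code<T code<T)
      ... | yes _ with divmod-unique p (l + e-1 * d) d p<d | divmod-unique l e-1 d l<d
      ... | q₁ , r₁ | q₂ , r₂ rewrite q₁ | r₁ | q₂ | r₂ = refl

  childSlots-valid : ∀ p l e e₁ → Valid (p , l , e) → e₁ ≤ e →
                     Valid (leftSlot (p , l , e) e₁) × Valid (rightSlot (p , l , e) e₁)
  childSlots-valid p l e zero    valid _ = ((z≤n , z≤n) , λ _ → refl , refl) , valid
  childSlots-valid p l e (suc w) valid@((p+e≤d , l+e≤d) , _) e₁≤e with suc w ≟ℕ e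
  ... | yes refl = valid , ((z≤n , z≤n) , λ _ → refl , refl)
  ... | no  e₁≢e = ((≤-trans (+-monoʳ-≤ p e₁≤e) p+e≤d , level-bound e₁<e) , λ ()) ,
                   ((≤-trans (≤-reflexive (trans (+-assoc p (suc w) (e ∸ suc w)) (cong (p +_) (m+[n∸m]≡n e₁≤e)))) p+e≤d ,
                     level-bound (∸-monoʳ-< (s≤s z≤n) e₁≤e)) ,
                    λ e∸e₁≡0 → ⊥-elim (<-irrefl refl (<-≤-trans e₁<e (m∸n≡0⇒m≤n e∸e₁≡0))))
    where
      e₁<e : suc w < e
      e₁<e = ≤∧≢⇒< e₁≤e e₁≢e
      level-bound : ∀ {x} → x < e → suc l + x ≤ d
      level-bound x<e = ≤-trans (≤-reflexive (sym (+-suc l _))) (≤-trans (+-monoʳ-≤ l x<e) l+e≤d)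

module SlotCircuit {c ℓ} (F : Field c ℓ) (n d : ℕ) .{{_ : NonZero d}} {s : ℕ}
                   (Ψ : Poly.NCircuit F n (suc s)) (d′ : ℕ) (d′≤d : d′ ≤ d) where
  open Poly F
  open Field F using (Carrier; 1#) renaming (refl to ≈-refl)
  open SlotEncoding d
  open FormalSums F {n} {d}
  open Placement F {n} {d}

  S slotSub : ℕ
  S       = suc s
  slotSub = suc d

  slotGate : AbsGate (Fin n) Carrier → ℕ → ℕ → Slot → ℕ → AbsGate (ZVar n d) Carrier
  slotGate g v τ σ w with inRange? σ
  ... | no _ = gadd []
  slotGate (gvar x) v τ (p , l , e) w | yes (p+e≤d , l+e≤d) with w ≟ℕ slotSub | e ≟ℕ 1
  ... | yes _ | yes refl = gvar (x , fromℕ< (≤-trans (≤-reflexive (+-comm 1 p)) p+e≤d) , fromℕ< (≤-trans (≤-reflexive (+-comm 1 l)) l+e≤d))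
  ... | _     | _        = gadd []
  slotGate (gcst a) v τ (p , l , e) w | yes _ with w ≟ℕ slotSub | e ≟ℕ 0
  ... | yes _ | yes _ = gcst a
  ... | _     | _     = gadd []
  slotGate (gadd ks) v τ (p , l , e) w | yes _ with w ≟ℕ slotSub
  ... | yes _ = gadd (map (λ c → code c τ slotSub) ks)
  ... | no  _ = gadd []
  slotGate (gmul x y) v τ (p , l , e) w | yes _ with w ≟ℕ slotSub | w ≤? e
  ... | yes _ | _     = gadd (map (code v τ) (downFrom (suc e)))
  ... | no  _ | yes _ = gmul (code x (slotCode (leftSlot (p , l , e) w)) slotSub) (code y (slotCode (rightSlot (p , l , e) w)) slotSub)
  ... | no  _ | no  _ = gadd []

  IsMul : AbsGate (Fin n) Carrier → Set
  IsMul (gmul _ _) = ⊤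
  IsMul _          = ⊥

  data SlotGateView : AbsGate (Fin n) Carrier → ℕ → ℕ → Slot → ℕ → AbsGate (ZVar n d) Carrier → Set c where
    outOfRange : ∀ {g v τ σ w} → ¬ InRange σ → SlotGateView g v τ σ w (gadd [])
    idle       : ∀ {g v τ σ w} → w ≢ slotSub → ¬ IsMul g → SlotGateView g v τ σ w (gadd [])
    idleMul    : ∀ {x y v τ p l e w} → InRange (p , l , e) → w ≢ slotSub → ¬ w ≤ e →
                 SlotGateView (gmul x y) v τ (p , l , e) w (gadd [])
    varSlot    : ∀ {x v τ p l j k} → InRange (p , l , 1) → toℕ j ≡ p → toℕ k ≡ l →
                 SlotGateView (gvar x) v τ (p , l , 1) slotSub (gvar (x , j , k))
    varOff     : ∀ {x v τ p l e} → InRange (p , l , e) → e ≢ 1 → SlotGateView (gvar x) v τ (p , l , e) slotSub (gadd [])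
    cstSlot    : ∀ {a v τ p l} → InRange (p , l , 0) → SlotGateView (gcst a) v τ (p , l , 0) slotSub (gcst a)
    cstOff     : ∀ {a v τ p l e} → InRange (p , l , e) → e ≢ 0 → SlotGateView (gcst a) v τ (p , l , e) slotSub (gadd [])
    addSlot    : ∀ {ks v τ σ} → InRange σ → SlotGateView (gadd ks) v τ σ slotSub (gadd (map (λ c → code c τ slotSub) ks))
    sumOfProducts : ∀ {x y v τ p l e} → InRange (p , l , e) →
                 SlotGateView (gmul x y) v τ (p , l , e) slotSub (gadd (map (code v τ) (downFrom (suc e))))
    product    : ∀ {x y v τ p l e w} → InRange (p , l , e) → w ≤ e →
                 SlotGateView (gmul x y) v τ (p , l , e) w
                   (gmul (code x (slotCode (leftSlot (p , l , e) w)) slotSub) (code y (slotCode (rightSlot (p , l , e) w)) slotSub))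

  view : ∀ g v τ σ w → SlotGateView g v τ σ w (slotGate g v τ σ w)
  view g v τ σ w with inRange? σ
  ... | no ¬inRange = outOfRange ¬inRange
  view (gvar x) v τ (p , l , e) w | yes inRange with w ≟ℕ slotSub | e ≟ℕ 1
  ... | yes refl | yes refl = varSlot inRange (toℕ-fromℕ< _) (toℕ-fromℕ< _)
  ... | yes refl | no  e≢1  = varOff inRange e≢1
  ... | no  w≢   | _        = idle w≢ λ ()
  view (gcst a) v τ (p , l , e) w | yes inRange with w ≟ℕ slotSub | e ≟ℕ 0
  ... | yes refl | yes refl = cstSlot inRange
  ... | yes refl | no  e≢0  = cstOff inRange e≢0
  ... | no  w≢   | _        = idle w≢ λ ()
  view (gadd ks) v τ (p , l , e) w | yes inRange with w ≟ℕ slotSub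
  ... | yes refl = addSlot inRange
  ... | no  w≢   = idle w≢ λ ()
  view (gmul x y) v τ (p , l , e) w | yes inRange with w ≟ℕ slotSub | w ≤? e
  ... | yes refl | _     = sumOfProducts inRange
  ... | no  w≢   | yes w≤e = product inRange w≤e
  ... | no  w≢   | no  w≰e = idleMul inRange w≢ w≰e

  slotSub<W : slotSub < W
  slotSub<W = ≤-refl

  outSlot : Slot
  outSlot = 0 , 0 , d′

  outSlot-valid : Valid outSlot
  outSlot-valid = (d′≤d , d′≤d) , λ _ → refl , refl

  outCode : ℕ
  outCode = code s (slotCode outSlot) slotSub

  gates : ℕ → AbsGate (ZVar n d) Carrier
  gates b with b <? S * K
  ... | yes _ = slotGate (gateAt Ψ (b / K)) (b / K) ((b % K) / W) (slotOf ((b % K) / W)) ((b % K) % W)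
  ... | no  _ = gadd (outCode ∷ [])

  gates-code : ∀ v τ w → v < S → τ ≤ T → w < W → gates (code v τ w) ≡ slotGate (gateAt Ψ v) v τ (slotOf τ) w
  gates-code v τ w v<S τ≤T w<W with code v τ w <? S * K
  ... | no  ¬< = ⊥-elim (¬< (code<S*K v τ w v<S τ≤T w<W))
  ... | yes _ with code-decode v τ w τ≤T w<W
  ... | e₁ , e₂ , e₃ rewrite e₁ | e₂ | e₃ = refl

  gates-output : gates (S * K) ≡ gadd (outCode ∷ [])
  gates-output with S * K <? S * K
  ... | yes SK<SK = ⊥-elim (<-irrefl refl SK<SK)
  ... | no  _     = refl

  outCode<S*K : outCode < S * K
  outCode<S*K = code<S*K s _ slotSub ≤-refl (proj₁ (slotCode-valid outSlot outSlot-valid)) slotSub<W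

  data Coded : ℕ → Set where
    coded : ∀ v τ w → v < S → τ ≤ T → w < W → Coded (code v τ w)

  coded? : ∀ b → b < S * K → Coded b
  coded? b b<SK = subst Coded (sym (code-surjective b)) (coded _ _ _ (m<n*o⇒m/o<n b<SK) (slotPart≤T b) (m%n<n (b % K) W))

  slot-valid : ∀ {σ τ} → σ ≡ slotOf τ → InRange σ → Valid σ
  slot-valid {τ = τ} refl = slotOf-valid τ

  childCodes : ∀ {p l e τ} w → (p , l , e) ≡ slotOf τ → InRange (p , l , e) → w ≤ e →
               (slotCode (leftSlot (p , l , e) w) ≤ T × slotOf (slotCode (leftSlot (p , l , e) w)) ≡ leftSlot (p , l , e) w) ×
               (slotCode (rightSlot (p , l , e) w) ≤ T × slotOf (slotCode (rightSlot (p , l , e) w)) ≡ rightSlot (p , l , e) w)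
  childCodes {p} {l} {e} w σ≡ inRange w≤e with childSlots-valid p l e w (slot-valid σ≡ inRange) w≤e
  ... | validL , validR = slotCode-valid _ validL , slotCode-valid _ validR

  summand<slotSub : ∀ {p l e e₁} → InRange (p , l , e) → e₁ < suc e → e₁ < slotSub
  summand<slotSub {l = l} {e} (_ , l+e≤d) e₁<1+e = ≤-trans e₁<1+e (s≤s (≤-trans (m≤n+m e l) l+e≤d))

  slotGate-refsBelow : ∀ {g v τ σ w out} → SlotGateView g v τ σ w out → σ ≡ slotOf τ →
                       RefsBelow v g → τ ≤ T → RefsBelow (code v τ w) out
  slotGate-refsBelow (outOfRange _)              _  _           _   = []
  slotGate-refsBelow (idle _ _)                  _  _           _   = []
  slotGate-refsBelow (idleMul _ _ _)             _  _           _   = []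
  slotGate-refsBelow (varSlot _ _ _)                 _  _           _   = tt
  slotGate-refsBelow (varOff _ _)                _  _           _   = []
  slotGate-refsBelow (cstSlot _)                     _  _           _   = tt
  slotGate-refsBelow (cstOff _ _)                _  _           _   = []
  slotGate-refsBelow {τ = τ} (addSlot _)             _  ks<v        τ≤T =
    All-map⁺ (All.map (λ c<v → code-<-gate τ slotSub c<v τ≤T slotSub<W) ks<v)
  slotGate-refsBelow {v = v} {τ} (sumOfProducts {e = e} inRange) _ _ _ =
    All-map⁺ (All.tabulate λ e₁∈ → code-<-sub v τ (summand<slotSub inRange (∈-downFrom⁻ e₁∈)))
  slotGate-refsBelow {τ = τ} {w = w} (product inRange w≤e) σ≡ (x<v , y<v) _
    with childCodes w σ≡ inRange w≤e
  ... | (τL≤T , _) , (τR≤T , _) = code-<-gate τ w x<v τL≤T slotSub<W , code-<-gate τ w y<v τR≤T slotSub<W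

  gates-refsBelow : ∀ b → b < suc (S * K) → RefsBelow b (gates b)
  gates-refsBelow b b<1+SK with m≤n⇒m<n∨m≡n (≤-pred b<1+SK)
  ... | inj₂ refl = subst (RefsBelow _) (sym gates-output) (outCode<S*K ∷ [])
  ... | inj₁ b<SK with coded? b b<SK
  ... | coded v τ w v<S τ≤T w<W =
    subst (RefsBelow _) (sym (gates-code v τ w v<S τ≤T w<W))
      (slotGate-refsBelow (view (gateAt Ψ v) v τ (slotOf τ) w) refl (gateAt-refsBelow Ψ v) τ≤T)

  Ψ′ : ZCircuit n d (suc (S * K))
  Ψ′ = circuit (suc (S * K)) gates gates-refsBelow

  module EvalZ = Evaluation F (cvar {n} {d}) cone _⊕_
  module EvalN = Evaluation F (λ (x : Fin n) → tree (leaf x)) one _⊗_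

  valueZ : ℕ → ZPoly n d
  valueZ = EvalZ.valueAt Ψ′

  valueN : ℕ → NPoly n
  valueN = EvalN.valueAt Ψ

  valueZ-code : ∀ v τ w → v < S → τ ≤ T → w < W →
                valueZ (code v τ w) ≡ EvalZ.evalStep (slotGate (gateAt Ψ v) v τ (slotOf τ) w) valueZ
  valueZ-code v τ w v<S τ≤T w<W =
    trans (EvalZ.valueAt-circuit _ gates gates-refsBelow _ (m<n⇒m<1+n (code<S*K v τ w v<S τ≤T w<W)))
          (cong (λ g → EvalZ.evalStep g valueZ) (gates-code v τ w v<S τ≤T w<W))

  SlotSound : ℕ → Set (c ⊔ˡ ℓ)
  SlotSound v = ∀ τ → τ ≤ T → InRange (slotOf τ) → valueZ (code v τ slotSub) ↭ Target (slotOf τ) (valueN v)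

  child-sound : ∀ σ → Valid σ → ∀ x → x < S → SlotSound x → valueZ (code x (slotCode σ) slotSub) ↭ Target σ (valueN x)
  child-sound σ valid x x<S sound with slotCode-valid σ valid
  ... | τ≤T , decode = subst (λ σ′ → valueZ (code x (slotCode σ) slotSub) ↭ Target σ′ (valueN x)) decode
                         (sound (slotCode σ) τ≤T (subst InRange (sym decode) (proj₁ valid)))

  homog-single-≢ : ∀ e a (m : NMon n) → deg m ≢ e → homog e ((a , m) ∷ []) ≡ []
  homog-single-≢ e a m deg≢e with deg m ≟ℕ e
  ... | yes deg≡e = ⊥-elim (deg≢e deg≡e)
  ... | no  _     = refl

  summand-sound : ∀ {x y v τ p l e e₁ out} → SlotGateView (gmul x y) v τ (p , l , e) e₁ out →
    (p , l , e) ≡ slotOf τ → InRange (p , l , e) → e₁ ≤ e → x < v → y < v → v < S → (∀ {v′} → v′ < v → SlotSound v′) →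
    EvalZ.evalStep out valueZ ↭ mulBy _⊕_ (Target (leftSlot (p , l , e) e₁) (valueN x)) (Target (rightSlot (p , l , e) e₁) (valueN y))
  summand-sound (outOfRange ¬inRange) _ inRange _ _ _ _ _ = ⊥-elim (¬inRange inRange)
  summand-sound (idle _ ¬mul)         _ _ _ _ _ _ _       = ⊥-elim (¬mul tt)
  summand-sound (idleMul _ _ ¬e₁≤e)   _ _ e₁≤e _ _ _ _    = ⊥-elim (¬e₁≤e e₁≤e)
  summand-sound (sumOfProducts _) _ (_ , l+e≤d) e₁≤e _ _ _ _ = ⊥-elim (<-irrefl refl (≤-trans e₁≤e (≤-trans (m≤n+m _ _) l+e≤d)))
  summand-sound {p = p} {l} {e} {e₁} (product _ _) σ≡ inRange e₁≤e x<v y<v v<S sound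
    with childSlots-valid p l e e₁ (slot-valid σ≡ inRange) e₁≤e
  ... | validL , validR = mulBy-↭ (child-sound _ validL _ (<-trans x<v v<S) (sound x<v))
                                  (child-sound _ validR _ (<-trans y<v v<S) (sound y<v))

  slot-sound : ∀ {g v τ σ out} → SlotGateView g v τ σ slotSub out → σ ≡ slotOf τ → InRange σ →
    gateAt Ψ v ≡ g → v < S → τ ≤ T → (∀ {v′} → v′ < v → SlotSound v′) →
    EvalZ.evalStep out valueZ ↭ Target σ (EvalN.evalStep g valueN)
  slot-sound (outOfRange ¬inRange) _ inRange _ _ _ _ = ⊥-elim (¬inRange inRange)
  slot-sound (idle ≢slotSub _)     _ _ _ _ _ _ = ⊥-elim (≢slotSub refl)
  slot-sound (idleMul _ ≢slotSub _) _ _ _ _ _ _ = ⊥-elim (≢slotSub refl)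
  slot-sound (varSlot {x = x} {j = j} {k} _ refl refl) _ _ _ _ _ _ = prep (≈-refl , cvar-φmonAtT x j k) ↭-refl
  slot-sound (varOff {x = x} {p = p} {l} {e} _ e≢1) _ _ _ _ _ _ =
    ↭-reflexive (sym (cong (map (placeE (p , l , e))) (homog-single-≢ e 1# (tree (leaf x)) (e≢1 ∘ sym))))
  slot-sound (cstSlot _) _ _ _ _ _ _ = ↭-refl
  slot-sound (cstOff {a = a} {p = p} {l} {e} _ e≢0) _ _ _ _ _ _ =
    ↭-reflexive (sym (cong (map (placeE (p , l , e))) (homog-single-≢ e a one (e≢0 ∘ sym))))
  slot-sound {v = v} {τ} (addSlot {ks = ks} _) refl inRange gate≡ v<S τ≤T sound = begin
    concatMap valueZ (map (λ c → code c τ slotSub) ks)     ≡⟨ concatMap-map valueZ _ ks ⟩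
    concatMap (λ c → valueZ (code c τ slotSub)) ks         ↭⟨ concatMap-↭ _ _ ks (λ c c∈ → sound (All.lookup ks<v c∈) τ τ≤T inRange) ⟩
    concatMap (Target (slotOf τ) ∘ valueN) ks              ≡⟨ sym (Target-concatMap (slotOf τ) valueN ks) ⟩
    Target (slotOf τ) (concatMap valueN ks)                ∎
    where
      open PermutationReasoning
      ks<v : All (_< v) ks
      ks<v = subst (RefsBelow v) gate≡ (gateAt-refsBelow Ψ v)
  slot-sound {v = v} {τ} (sumOfProducts {x = x} {y} {p = p} {l} {e} inRange) σ≡ _ gate≡ v<S τ≤T sound = begin
    concatMap valueZ (map (code v τ) (downFrom (suc e)))   ≡⟨ concatMap-map valueZ _ (downFrom (suc e)) ⟩
    concatMap (valueZ ∘ code v τ) (downFrom (suc e))       ↭⟨ concatMap-↭ _ _ (downFrom (suc e)) summand ⟩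
    concatMap (λ e₁ → mulBy _⊕_ (Target (leftSlot σ e₁) (valueN x)) (Target (rightSlot σ e₁) (valueN y))) (downFrom (suc e))
                                                           ↭⟨ ↭-sym (Target-mulBy p l e (valueN x) (valueN y)) ⟩
    Target σ (mulBy _⊗_ (valueN x) (valueN y))             ∎
    where
      open PermutationReasoning
      σ = (p , l , e)
      xy<v : x < v × y < v
      xy<v = subst (RefsBelow v) gate≡ (gateAt-refsBelow Ψ v)
      summand : ∀ e₁ → e₁ ∈ downFrom (suc e) →
                valueZ (code v τ e₁) ↭ mulBy _⊕_ (Target (leftSlot σ e₁) (valueN x)) (Target (rightSlot σ e₁) (valueN y))
      summand e₁ e₁∈ = ↭-trans
        (↭-reflexive (trans (valueZ-code v τ e₁ v<S τ≤T (<-trans (summand<slotSub inRange e₁<1+e) slotSub<W))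
                            (cong₂ (λ g σ′ → EvalZ.evalStep (slotGate g v τ σ′ e₁) valueZ) gate≡ (sym σ≡))))
        (summand-sound (view (gmul x y) v τ σ e₁) σ≡ inRange (≤-pred e₁<1+e) (proj₁ xy<v) (proj₂ xy<v) v<S sound)
        where e₁<1+e = ∈-downFrom⁻ e₁∈
  slot-sound (product (_ , l+e≤d) slotSub≤e) _ _ _ _ _ _ = ⊥-elim (<-irrefl refl (≤-trans slotSub≤e (≤-trans (m≤n+m _ _) l+e≤d)))

  slots-sound : ∀ v → v < S → SlotSound v
  slots-sound = <-rec (λ v → v < S → SlotSound v) λ v sound v<S τ τ≤T inRange →
    let open PermutationReasoning in begin
    valueZ (code v τ slotSub)
      ≡⟨ valueZ-code v τ slotSub v<S τ≤T slotSub<W ⟩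
    EvalZ.evalStep (slotGate (gateAt Ψ v) v τ (slotOf τ) slotSub) valueZ
      ↭⟨ slot-sound (view (gateAt Ψ v) v τ (slotOf τ) slotSub) refl inRange refl v<S τ≤T
                    (λ v′<v → sound v′<v (<-trans v′<v v<S)) ⟩
    Target (slotOf τ) (EvalN.evalStep (gateAt Ψ v) valueN)
      ≡⟨ cong (Target (slotOf τ)) (sym (EvalN.valueAt-local Ψ v v<S)) ⟩
    Target (slotOf τ) (valueN v) ∎

  computes : zOutput Ψ′ ≈Z φ (homog d′ (nOutput Ψ))
  computes = zcoeff-↭ (begin
    zOutput Ψ′                  ≡⟨ EvalZ.evalAt-zero-valueAt Ψ′ ⟩
    valueZ (S * K)              ≡⟨ EvalZ.valueAt-circuit _ gates gates-refsBelow (S * K) ≤-refl ⟩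
    EvalZ.evalStep (gates (S * K)) valueZ ≡⟨ cong (λ g → EvalZ.evalStep g valueZ) gates-output ⟩
    valueZ outCode ++ []        ≡⟨ ++-identityʳ _ ⟩
    valueZ outCode              ↭⟨ child-sound outSlot outSlot-valid s ≤-refl (slots-sound s ≤-refl) ⟩
    Target outSlot (valueN s)   ≡⟨ cong (Target outSlot) (sym (EvalN.evalAt-zero-valueAt Ψ)) ⟩
    Target outSlot (nOutput Ψ)  ↭⟨ Target-origin d′ (nOutput Ψ) ⟩
    φ (homog d′ (nOutput Ψ))    ∎)
    where open PermutationReasoning

  Placed : Slot → Maybe (BTree (ZVar n d)) → Set
  Placed (p , l , e) r = (e ≡ 0 × r ≡ nothing) ⊎ (∃ λ t → r ≡ just t × Positioned p l t × leafCount t ≡ e)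

  Placed⇒PositionedOrEmpty : ∀ σ {r} → Placed σ r → PositionedOrEmpty r
  Placed⇒PositionedOrEmpty σ           (inj₁ (_ , r≡)) = inj₁ r≡
  Placed⇒PositionedOrEmpty (p , l , e) (inj₂ (t , r≡ , pt , _)) = inj₂ (t , r≡ , p , l , pt)

  join-placed : ∀ p l e w {r₁ r₂} → w ≤ e → Placed (leftSlot (p , l , e) w) r₁ → Placed (rightSlot (p , l , e) w) r₂ →
                Placed (p , l , e) (join r₁ r₂)
  join-placed p l e zero w≤e (inj₁ (_ , refl)) placed₂ = placed₂
  join-placed p l e zero w≤e (inj₂ (t , _ , _ , t≡0)) _ = ⊥-elim (<-irrefl (sym t≡0) (leafCount≥1 t))
  join-placed p l e (suc w) w≤e placed₁ placed₂ with suc w ≟ℕ e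
  join-placed p l e (suc w) w≤e (inj₁ (() , _)) _ | yes refl
  join-placed p l e (suc w) w≤e (inj₂ (t , refl , pt , t≡e)) (inj₁ (_ , refl)) | yes refl = inj₂ (t , refl , pt , t≡e)
  join-placed p l e (suc w) w≤e (inj₂ _) (inj₂ (u , _ , _ , u≡0)) | yes refl = ⊥-elim (<-irrefl (sym u≡0) (leafCount≥1 u))
  join-placed p l e (suc w) w≤e (inj₁ (() , _)) _ | no _
  join-placed p l e (suc w) w≤e (inj₂ _) (inj₁ (e∸w≡0 , _)) | no w≢e =
    ⊥-elim (w≢e (≤-antisym w≤e (m∸n≡0⇒m≤n e∸w≡0)))
  join-placed p l e (suc w) w≤e (inj₂ (t , refl , pt , t≡w)) (inj₂ (u , refl , pu , u≡e∸w)) | no _ =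
    inj₂ (node t u , refl , (pt , subst (λ q → Positioned (p + q) (suc l) u) (sym t≡w) pu) ,
          trans (cong₂ _+_ t≡w u≡e∸w) (m+[n∸m]≡n w≤e))

  PlacedAt : ℕ → Maybe (BTree (ZVar n d)) → Set
  PlacedAt b r = ∀ v τ w → b ≡ code v τ w → v < S → τ ≤ T → w < W → Placed (slotOf τ) r

  child-placed : ∀ σ → Valid σ → ∀ {x r} → x < S → PlacedAt (code x (slotCode σ) slotSub) r → Placed σ r
  child-placed σ valid x<S placed with slotCode-valid σ valid
  ... | τ≤T , decode = subst (λ σ′ → Placed σ′ _) decode (placed _ _ slotSub refl x<S τ≤T slotSub<W)

  slotLayer-placed : ∀ {g v τ σ w out} → SlotGateView g v τ σ w out → σ ≡ slotOf τ → gateAt Ψ v ≡ g → v < S → τ ≤ T →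
                     ∀ {r} → ParseLayer F out PlacedAt r → Placed σ r
  slotLayer-placed (outOfRange _)  _ _ _ _ (_ , () , _)
  slotLayer-placed (idle _ _)      _ _ _ _ (_ , () , _)
  slotLayer-placed (idleMul _ _ _) _ _ _ _ (_ , () , _)
  slotLayer-placed (varOff _ _)    _ _ _ _ (_ , () , _)
  slotLayer-placed (cstOff _ _)    _ _ _ _ (_ , () , _)
  slotLayer-placed (varSlot _ j≡p k≡l) _ _ _ _ refl = inj₂ (leaf _ , refl , (j≡p , k≡l) , refl)
  slotLayer-placed (cstSlot _)         _ _ _ _ refl = inj₁ (refl , refl)
  slotLayer-placed {v = v} {τ} (addSlot {ks = ks} _) refl gate≡ v<S τ≤T (k , k∈ , placed) with ∈-map⁻ (λ c → code c τ slotSub) k∈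
  ... | c , c∈ks , refl = placed c τ slotSub refl (<-trans (All.lookup (subst (RefsBelow v) gate≡ (gateAt-refsBelow Ψ v)) c∈ks) v<S) τ≤T slotSub<W
  slotLayer-placed {v = v} {τ} (sumOfProducts {e = e} inRange) σ≡ _ v<S τ≤T (k , k∈ , placed) with ∈-map⁻ (code v τ) k∈
  ... | e₁ , e₁∈ , refl =
    subst (λ σ → Placed σ _) (sym σ≡) (placed v τ e₁ refl v<S τ≤T (<-trans (summand<slotSub inRange (∈-downFrom⁻ e₁∈)) slotSub<W))
  slotLayer-placed {v = v} (product {p = p} {l} {e} {w} inRange w≤e) σ≡ gate≡ v<S _ (r₁ , r₂ , refl , placed₁ , placed₂)
    with childSlots-valid p l e w (slot-valid σ≡ inRange) w≤e | subst (RefsBelow v) gate≡ (gateAt-refsBelow Ψ v)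
  ... | validL , validR | x<v , y<v =
    join-placed p l e w w≤e (child-placed _ validL (<-trans x<v v<S) placed₁) (child-placed _ validR (<-trans y<v v<S) placed₂)

  layer-placed : ∀ {b r} → ParseLayer F (gates b) PlacedAt r → PlacedAt b r
  layer-placed layer v τ w refl v<S τ≤T w<W =
    slotLayer-placed (view (gateAt Ψ v) v τ (slotOf τ) w) refl refl v<S τ≤T
      (subst (λ g → ParseLayer F g PlacedAt _) (gates-code v τ w v<S τ≤T w<W) layer)

  parse-positioned : ∀ {b r} → b < suc (S * K) → Parse F gates b r → PositionedOrEmpty r
  parse-positioned {b} b<1+SK p with m≤n⇒m<n∨m≡n (≤-pred b<1+SK)
  ... | inj₁ b<SK with coded? b b<SK
  ... | coded v τ w v<S τ≤T w<W =
    Placed⇒PositionedOrEmpty _ (layer-placed (parse-fold F PlacedAt layer-placed p) v τ w refl v<S τ≤T w<W)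
  parse-positioned b<1+SK p | inj₂ refl with subst (λ g → ParseLayer F g PlacedAt _) gates-output (parse-fold F PlacedAt layer-placed p)
  ... | _ , here refl , placed = Placed⇒PositionedOrEmpty outSlot (child-placed outSlot outSlot-valid ≤-refl placed)

  unambiguous : Unambiguous Ψ′
  unambiguous = unambiguous-if-positioned F Ψ′ λ g r p →
    parse-positioned (absIndex<m g)
      (Parse-transport F (λ b b<N → gateAt-circuit _ gates gates-refsBelow b b<N) (gateAt-beyond Ψ′) (RPT→Parse F p))

  depthZ depthN : ℕ → ℕ
  depthZ = depthAt Ψ′
  depthN = depthAt Ψ

  DepthBounded : ℕ → Set
  DepthBounded b = ∀ v τ w → b ≡ code v τ w → v < S → τ ≤ T → w < W → depthZ b ≤ depthN v

  depthN-local : ∀ {v g} → v < S → gateAt Ψ v ≡ g → depthN v ≡ depthStep g depthN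
  depthN-local {v} v<S gate≡ = trans (depthAt-local Ψ v v<S) (cong (λ g → depthStep g depthN) gate≡)

  slotGate-depth : ∀ {g v τ σ w out} → SlotGateView g v τ σ w out → σ ≡ slotOf τ → gateAt Ψ v ≡ g → v < S → τ ≤ T →
                   (∀ {b} → b < code v τ w → DepthBounded b) → depthStep out depthZ ≤ depthN v
  slotGate-depth (outOfRange _)  _ _ _ _ _ = z≤n
  slotGate-depth (idle _ _)      _ _ _ _ _ = z≤n
  slotGate-depth (idleMul _ _ _) _ _ _ _ _ = z≤n
  slotGate-depth (varSlot _ _ _)     _ _ _ _ _ = z≤n
  slotGate-depth (varOff _ _)    _ _ _ _ _ = z≤n
  slotGate-depth (cstSlot _)         _ _ _ _ _ = z≤n
  slotGate-depth (cstOff _ _)    _ _ _ _ _ = z≤n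
  slotGate-depth {v = v} {τ} (addSlot {ks = ks} _) _ gate≡ v<S τ≤T bounded = begin
    maxL (map depthZ (map (λ c → code c τ slotSub) ks))  ≡⟨ cong maxL (sym (map-∘ ks)) ⟩
    maxL (map (λ c → depthZ (code c τ slotSub)) ks)      ≤⟨ maxL-map-mono _ _ ks child ⟩
    maxL (map depthN ks)                                 ≡⟨ sym (depthN-local v<S gate≡) ⟩
    depthN v                                             ∎
    where
      open ≤-Reasoning
      ks<v = subst (RefsBelow v) gate≡ (gateAt-refsBelow Ψ v)
      child : ∀ c → c ∈ ks → depthZ (code c τ slotSub) ≤ depthN c
      child c c∈ = let c<v = All.lookup ks<v c∈ in
        bounded (code-<-gate τ slotSub c<v τ≤T slotSub<W) c τ slotSub refl (<-trans c<v v<S) τ≤T slotSub<W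
  slotGate-depth {v = v} {τ} (sumOfProducts {e = e} inRange) _ _ v<S τ≤T bounded =
    subst (_≤ depthN v) (cong maxL (map-∘ (downFrom (suc e))))
      (maxL-map-≤ _ (downFrom (suc e)) λ e₁ e₁∈ → let e₁<slotSub = summand<slotSub inRange (∈-downFrom⁻ e₁∈) in
         bounded (code-<-sub v τ e₁<slotSub) v τ e₁ refl v<S τ≤T (<-trans e₁<slotSub slotSub<W))
  slotGate-depth {v = v} {τ} (product {x = x} {y} {p = p} {l} {e} {w} inRange w≤e) σ≡ gate≡ v<S τ≤T bounded
    with childCodes w σ≡ inRange w≤e | subst (RefsBelow v) gate≡ (gateAt-refsBelow Ψ v)
  ... | (τL≤T , _) , (τR≤T , _) | x<v , y<v = begin
    suc (depthZ (code x τL slotSub) ⊔ depthZ (code y τR slotSub))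
      ≤⟨ s≤s (⊔-mono-≤ (bounded (code-<-gate τ w x<v τL≤T slotSub<W) x τL slotSub refl (<-trans x<v v<S) τL≤T slotSub<W)
                       (bounded (code-<-gate τ w y<v τR≤T slotSub<W) y τR slotSub refl (<-trans y<v v<S) τR≤T slotSub<W)) ⟩
    suc (depthN x ⊔ depthN y) ≡⟨ sym (depthN-local v<S gate≡) ⟩
    depthN v ∎
    where
      open ≤-Reasoning
      τL = slotCode (leftSlot (p , l , e) w)
      τR = slotCode (rightSlot (p , l , e) w)

  depth-bounded : ∀ b → DepthBounded b
  depth-bounded = <-rec DepthBounded step
    where
      step : ∀ b → (∀ {b′} → b′ < b → DepthBounded b′) → DepthBounded b
      step _ bounded v τ w refl v<S τ≤T w<W = begin
        depthZ (code v τ w)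
          ≡⟨ depthAt-circuit _ gates gates-refsBelow _ (m<n⇒m<1+n (code<S*K v τ w v<S τ≤T w<W)) ⟩
        depthStep (gates (code v τ w)) depthZ
          ≡⟨ cong (λ g → depthStep g depthZ) (gates-code v τ w v<S τ≤T w<W) ⟩
        depthStep (slotGate (gateAt Ψ v) v τ (slotOf τ) w) depthZ
          ≤⟨ slotGate-depth (view (gateAt Ψ v) v τ (slotOf τ) w) refl refl v<S τ≤T bounded ⟩
        depthN v ∎
        where open ≤-Reasoning

  depth-preserved : pdepth Ψ′ ≤ pdepth Ψ
  depth-preserved = begin
    pdepth Ψ′                         ≡⟨ pdepth-depthAt Ψ′ ⟩
    depthZ (S * K)                    ≡⟨ depthAt-circuit _ gates gates-refsBelow (S * K) ≤-refl ⟩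
    depthStep (gates (S * K)) depthZ  ≡⟨ cong (λ g → depthStep g depthZ) gates-output ⟩
    depthZ outCode ⊔ 0               ≤⟨ ⊔-lub (depth-bounded outCode s _ slotSub refl ≤-refl outτ≤T slotSub<W) z≤n ⟩
    depthN s                          ≡⟨ sym (pdepth-depthAt Ψ) ⟩
    pdepth Ψ                          ∎
    where
      open ≤-Reasoning
      outτ≤T = proj₁ (slotCode-valid outSlot outSlot-valid)

  size-bound : 2 ≤ d → size Ψ′ ≤ 3 * d ^ 4 * size Ψ
  size-bound 2≤d = begin
    suc (S * K)        ≤⟨ +-monoˡ-≤ (S * K) (s≤s z≤n) ⟩
    S + S * K          ≡⟨ sym (*-suc S K) ⟩
    S * suc K          ≤⟨ *-monoʳ-≤ S (blockSize-bound d 2≤d) ⟩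
    S * (3 * d ^ 4)    ≡⟨ *-comm S _ ⟩
    3 * d ^ 4 * S      ∎
    where open ≤-Reasoning

-- Degree at most one

module LinearPart {c ℓ} (F : Field c ℓ) (n : ℕ) where
  open Poly F
  open Field F using (Carrier; 1#) renaming (refl to ≈-refl)
  open FormalSums F {n} {1}
  open Placement F {n} {1}

  z₁ : Fin n → ZVar n 1
  z₁ i = i , zero , zero

  linearPart : ∀ {m} → NCircuit n m → ZCircuit n 1 m
  linearPart []            = []
  linearPart (var x ∷ Ψ)   = var (z₁ x) ∷ linearPart Ψ
  linearPart (cst _ ∷ Ψ)   = add [] ∷ linearPart Ψ
  linearPart (add ks ∷ Ψ)  = add ks ∷ linearPart Ψ
  linearPart (mul _ _ ∷ Ψ) = add [] ∷ linearPart Ψ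

  evalZ : ∀ {m} → ZCircuit n 1 m → Fin m → ZPoly n 1
  evalZ = evalAt cvar cone _⊕_

  evalN : ∀ {m} → NCircuit n m → Fin m → NPoly n
  evalN = evalAt (λ x → tree (leaf x)) one _⊗_

  -- Without product gates below it, a gate computes a polynomial of degree at most 1.
  linearPart-sound : ∀ {m} (Ψ : NCircuit n m) g → pdepthAt Ψ g ≡ 0 →
                     evalZ (linearPart Ψ) g ↭ Target (0 , 0 , 1) (evalN Ψ g)
  linearPart-sound (var x ∷ Ψ)   zero    _  = prep (≈-refl , cvar-φmonAtT x zero zero) ↭-refl
  linearPart-sound (cst _ ∷ Ψ)   zero    _  = ↭-refl
  linearPart-sound (add ks ∷ Ψ)  zero    d≡0 = ↭-trans
    (concatMap-↭ _ _ ks λ k k∈ → linearPart-sound Ψ k (n≤0⇒n≡0 (subst (pdepthAt Ψ k ≤_) d≡0 (≤-maxL-map (pdepthAt Ψ) k∈))))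
    (↭-reflexive (sym (Target-concatMap (0 , 0 , 1) (evalN Ψ) ks)))
  linearPart-sound (var _ ∷ Ψ)   (suc g) d≡0 = linearPart-sound Ψ g d≡0
  linearPart-sound (cst _ ∷ Ψ)   (suc g) d≡0 = linearPart-sound Ψ g d≡0
  linearPart-sound (add _ ∷ Ψ)   (suc g) d≡0 = linearPart-sound Ψ g d≡0
  linearPart-sound (mul _ _ ∷ Ψ) (suc g) d≡0 = linearPart-sound Ψ g d≡0

  linearPart-depth : ∀ {m} (Ψ : NCircuit n m) g → pdepthAt (linearPart Ψ) g ≤ pdepthAt Ψ g
  linearPart-depth (var _ ∷ Ψ)   zero    = z≤n
  linearPart-depth (cst _ ∷ Ψ)   zero    = z≤n
  linearPart-depth (add ks ∷ Ψ)  zero    = maxL-map-mono _ _ ks λ k _ → linearPart-depth Ψ k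
  linearPart-depth (mul _ _ ∷ Ψ) zero    = z≤n
  linearPart-depth (var _ ∷ Ψ)   (suc g) = linearPart-depth Ψ g
  linearPart-depth (cst _ ∷ Ψ)   (suc g) = linearPart-depth Ψ g
  linearPart-depth (add _ ∷ Ψ)   (suc g) = linearPart-depth Ψ g
  linearPart-depth (mul _ _ ∷ Ψ) (suc g) = linearPart-depth Ψ g

  linearPart-pdepth : ∀ {s} (Ψ : NCircuit n (suc s)) → pdepth (linearPart Ψ) ≤ pdepth Ψ
  linearPart-pdepth Ψ = linearPart-depth Ψ zero

  linearPart-leaves : ∀ {m} (Ψ : NCircuit n m) g {r} → RPT (linearPart Ψ) g r → ∃ λ i → r ≡ just (leaf (z₁ i))
  linearPart-leaves (var x ∷ Ψ)   zero    (rvar _)     = x , refl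
  linearPart-leaves (cst _ ∷ Ψ)   zero    (radd () _)
  linearPart-leaves (add ks ∷ Ψ)  zero    (radd _ p)   = linearPart-leaves Ψ _ p
  linearPart-leaves (mul _ _ ∷ Ψ) zero    (radd () _)
  linearPart-leaves (var _ ∷ Ψ)   (suc g) (there p)    = linearPart-leaves Ψ g p
  linearPart-leaves (cst _ ∷ Ψ)   (suc g) (there p)    = linearPart-leaves Ψ g p
  linearPart-leaves (add _ ∷ Ψ)   (suc g) (there p)    = linearPart-leaves Ψ g p
  linearPart-leaves (mul _ _ ∷ Ψ) (suc g) (there p)    = linearPart-leaves Ψ g p

  linearPart-unambiguous : ∀ {m} (Ψ : NCircuit n m) → Unambiguous (linearPart Ψ)
  linearPart-unambiguous Ψ = unambiguous-if-positioned F (linearPart Ψ) λ g r p →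
    let i , r≡ = linearPart-leaves Ψ g p in inj₂ (leaf (z₁ i) , r≡ , 0 , 0 , refl , refl)

  linearPart-computes : ∀ {s} (Ψ : NCircuit n (suc s)) → pdepth Ψ ≡ 0 → zOutput (linearPart Ψ) ≈Z φ (homog 1 (nOutput Ψ))
  linearPart-computes Ψ d≡0 = zcoeff-↭ (↭-trans (linearPart-sound Ψ zero d≡0) (Target-origin 1 (nOutput Ψ)))

module ConstantPart {c ℓ} (F : Field c ℓ) (n d : ℕ) where
  open Poly F
  open Field F using (_≈_; 0#; +-cong)
    renaming (+-identityʳ to +ᶠ-identityʳ; refl to ≈-refl; sym to ≈-sym; trans to ≈-trans; reflexive to ≈-reflexive)
  open FormalSums F {n} {d} using (_≗C_)

  constantPart : NPoly n → ZCircuit n d 1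
  constantPart f = cst (ncoeff f one) ∷ []

  homog0-coeff : ∀ (f : NPoly n) μ → cone ≗C μ → zcoeff (φ (homog 0 f)) μ ≈ ncoeff f one
  homog0-coeff []                    μ _ = ≈-refl
  homog0-coeff ((a , one)    ∷ f) μ eq =
    ≈-trans (coeffBy-∷ F cmon-≟ a cone _ μ) (+-cong (≈-reflexive (pick-yes F (cmon-≟ cone μ) a eq)) (homog0-coeff f μ eq))
  homog0-coeff ((a , tree t) ∷ f) μ eq with deg (tree t) ≟ℕ 0
  ... | yes t≡0 = ⊥-elim (<-irrefl (sym t≡0) (leafCount≥1 t))
  ... | no  _   = homog0-coeff f μ eq

  homog0-coeff-≉ : ∀ (f : NPoly n) μ → ¬ cone ≗C μ → zcoeff (φ (homog 0 f)) μ ≈ 0#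
  homog0-coeff-≉ []                 μ _  = ≈-refl
  homog0-coeff-≉ ((a , one)    ∷ f) μ ne = ≈-trans (coeffBy-∷ F cmon-≟ a cone _ μ)
    (≈-trans (+-cong (≈-reflexive (pick-no F (cmon-≟ cone μ) a ne)) (homog0-coeff-≉ f μ ne)) (+ᶠ-identityʳ 0#))
  homog0-coeff-≉ ((a , tree t) ∷ f) μ ne with deg (tree t) ≟ℕ 0
  ... | yes t≡0 = ⊥-elim (<-irrefl (sym t≡0) (leafCount≥1 t))
  ... | no  _   = homog0-coeff-≉ f μ ne

  constantPart-computes : ∀ f → zOutput (constantPart f) ≈Z φ (homog 0 f)
  constantPart-computes f μ with cmon-≟ cone μ
  ... | yes eq = ≈-trans (+ᶠ-identityʳ _) (≈-sym (homog0-coeff f μ eq))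
  ... | no  ne = ≈-sym (homog0-coeff-≉ f μ ne)

  constantPart-unambiguous : ∀ f → Unambiguous (constantPart f)
  constantPart-unambiguous f = unambiguous-if-positioned F (constantPart f) λ { zero nothing (rcst _) → inj₁ refl }

length-deduplicate : ∀ {A : Set} (_≟_ : DecidableEquality A) xs → length (deduplicate _≟_ xs) ≤ length xs
length-deduplicate _≟_ []       = z≤n
length-deduplicate _≟_ (x ∷ xs) = s≤s (≤-trans (length-filter _ (deduplicate _≟_ xs)) (length-deduplicate _≟_ xs))

module FlatLinearPart {c ℓ} (F : Field c ℓ) (n : ℕ) where
  open Poly F
  open Field F using (Carrier; _≈_; 0#; 1#; +-cong; setoid)
    renaming (_+_ to _+ᶠ_; _*_ to _·_; +-commutativeSemigroup to +ᶠ-commutativeSemigroup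
             ; +-identityˡ to +ᶠ-identityˡ; +-identityʳ to +ᶠ-identityʳ; *-identityʳ to ·-identityʳ
             ; refl to ≈-refl; sym to ≈-sym; trans to ≈-trans; reflexive to ≈-reflexive)
  open FormalSums F {n} {1} using (_≗C_; contribution; contribution-cong; zcoeff-sum)
  open Placement F {n} {1} using (mulN)
  open LinearPart F n using (z₁)
  open import Algebra.Properties.CommutativeSemigroup +ᶠ-commutativeSemigroup using (interchange)

  variables : ∀ {m} → NCircuit n m → List (Fin n)
  variables []            = []
  variables (var x ∷ Ψ)   = x ∷ variables Ψ
  variables (cst _ ∷ Ψ)   = variables Ψ
  variables (add _ ∷ Ψ)   = variables Ψ
  variables (mul _ _ ∷ Ψ) = variables Ψ

  length-variables : ∀ {m} (Ψ : NCircuit n m) → length (variables Ψ) ≤ m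
  length-variables []            = z≤n
  length-variables (var _ ∷ Ψ)   = s≤s (length-variables Ψ)
  length-variables (cst _ ∷ Ψ)   = m≤n⇒m≤1+n (length-variables Ψ)
  length-variables (add _ ∷ Ψ)   = m≤n⇒m≤1+n (length-variables Ψ)
  length-variables (mul _ _ ∷ Ψ) = m≤n⇒m≤1+n (length-variables Ψ)

  -- A circuit of positive product depth does not have a variable as its output gate.
  length-variables-≤ : ∀ {s} (Ψ : NCircuit n (suc s)) → 1 ≤ pdepth Ψ → length (variables Ψ) ≤ s
  length-variables-≤ (cst _ ∷ Ψ)   _ = length-variables Ψ
  length-variables-≤ (add _ ∷ Ψ)   _ = length-variables Ψ
  length-variables-≤ (mul _ _ ∷ Ψ) _ = length-variables Ψ

  monLabels : NMon n → List (Fin n)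
  monLabels one      = []
  monLabels (tree t) = labels t

  monLabels-⊗ : ∀ m m′ → monLabels (m ⊗ m′) ≡ monLabels m ++ monLabels m′
  monLabels-⊗ one      m′       = refl
  monLabels-⊗ (tree t) one      = sym (++-identityʳ (labels t))
  monLabels-⊗ (tree t) (tree u) = refl

  evalN : ∀ {m} → NCircuit n m → Fin m → NPoly n
  evalN = evalAt (λ x → tree (leaf x)) one _⊗_

  evalN-variables : ∀ {m} (Ψ : NCircuit n m) g {x} → x ∈ evalN Ψ g → All (_∈ variables Ψ) (monLabels (proj₂ x))
  evalN-variables (var y ∷ Ψ)   zero (here refl) = here refl ∷ []
  evalN-variables (cst _ ∷ Ψ)   zero (here refl) = []
  evalN-variables (add ks ∷ Ψ)  zero x∈ with find (∈-concatMap⁻ (evalN Ψ) {ks} x∈)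
  ... | k , _ , x∈k = evalN-variables Ψ k x∈k
  evalN-variables (mul p q ∷ Ψ) zero x∈ with find (∈-concatMap⁻ (λ y → map (mulN y) (evalN Ψ q)) {evalN Ψ p} x∈)
  ... | y , y∈ , x∈yq with ∈-map⁻ (mulN y) x∈yq
  ...   | z , z∈ , refl = subst (All (_∈ variables Ψ)) (sym (monLabels-⊗ (proj₂ y) (proj₂ z)))
                            (All-++⁺ (evalN-variables Ψ p y∈) (evalN-variables Ψ q z∈))
  evalN-variables (var _ ∷ Ψ)   (suc g) x∈ = All.map there (evalN-variables Ψ g x∈)
  evalN-variables (cst _ ∷ Ψ)   (suc g) x∈ = evalN-variables Ψ g x∈
  evalN-variables (add _ ∷ Ψ)   (suc g) x∈ = evalN-variables Ψ g x∈
  evalN-variables (mul _ _ ∷ Ψ) (suc g) x∈ = evalN-variables Ψ g x∈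

  ρ : Fin n → CMon n 1
  ρ i = cvar (z₁ i)

  φmon-leaf : ∀ i → φmon (tree (leaf i)) ≗C ρ i
  φmon-leaf i i′ zero zero = refl

  flat : (Fin n → Carrier) → (W : List (Fin n)) → ZCircuit n 1 (length W * 3)
  flat a []      = []
  flat a (i ∷ W) = mul zero (suc zero) ∷ cst (a i) ∷ var (z₁ i) ∷ flat a W

  roots : (W : List (Fin n)) → List (Fin (length W * 3))
  roots []      = []
  roots (i ∷ W) = zero ∷ map (λ x → suc (suc (suc x))) (roots W)

  flatSum : (Fin n → Carrier) → (W : List (Fin n)) → ZCircuit n 1 (suc (length W * 3))
  flatSum a W = add (roots W) ∷ flat a W

  flat-roots : ∀ a W → concatMap (evalAt cvar cone _⊕_ (flat a W)) (roots W) ≡ map (λ i → a i · 1# , cone ⊕ ρ i) W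
  flat-roots a []      = refl
  flat-roots a (i ∷ W) = cong ((a i · 1# , cone ⊕ ρ i) ∷_)
    (trans (concatMap-map (evalAt cvar cone _⊕_ (flat a (i ∷ W))) _ (roots W)) (flat-roots a W))

  sumOver : List (Fin n) → (Fin n → Carrier) → Carrier
  sumOver W g = sumC (map g W)

  sumOver-cong : ∀ W {g h} → (∀ i → g i ≈ h i) → sumOver W g ≈ sumOver W h
  sumOver-cong []      g≈h = ≈-refl
  sumOver-cong (i ∷ W) g≈h = +-cong (g≈h i) (sumOver-cong W g≈h)

  sumOver-+ : ∀ W g h → sumOver W (λ i → g i +ᶠ h i) ≈ sumOver W g +ᶠ sumOver W h
  sumOver-+ []      g h = ≈-sym (+ᶠ-identityʳ 0#)
  sumOver-+ (i ∷ W) g h = ≈-trans (+-cong ≈-refl (sumOver-+ W g h)) (interchange (g i) (h i) _ _)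

  sumOver-0 : ∀ W g → (∀ i → i ∈ W → g i ≈ 0#) → sumOver W g ≈ 0#
  sumOver-0 []      g g≈0 = ≈-refl
  sumOver-0 (i ∷ W) g g≈0 = ≈-trans (+-cong (g≈0 i (here refl)) (sumOver-0 W g λ j j∈ → g≈0 j (there j∈))) (+ᶠ-identityʳ 0#)

  sumOver-single : ∀ W g {i₀} → Unique W → i₀ ∈ W → (∀ i → i ≢ i₀ → g i ≈ 0#) → sumOver W g ≈ g i₀
  sumOver-single (i ∷ W) g (i∉W ∷ _) (here refl) g≈0 =
    ≈-trans (+-cong ≈-refl (sumOver-0 W g λ j j∈ → g≈0 j λ { refl → All.lookup i∉W j∈ refl })) (+ᶠ-identityʳ _)
  sumOver-single (i ∷ W) g (i∉W ∷ unique) (there i₀∈) g≈0 =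
    ≈-trans (+-cong (g≈0 i (All.lookup i∉W i₀∈)) (sumOver-single W g unique i₀∈ g≈0)) (+ᶠ-identityˡ _)

  module _ (μ : CMon n 1) where

    weigh : Fin n → Carrier → Carrier
    weigh i b = pick F (cmon-≟ (ρ i) μ) b

    flatSum-coeff : ∀ (a : Fin n → Carrier) W → zcoeff (map (λ i → a i · 1# , cone ⊕ ρ i) W) μ ≈ sumOver W (λ i → weigh i (a i))
    flatSum-coeff a W = ≈-trans (zcoeff-sum (map entry W) μ) (≈-trans (≈-reflexive (cong sumC (sym (map-∘ {g = contribution μ} {f = entry} W))))
                          (sumOver-cong W λ i → contribution-cong μ (·-identityʳ (a i) , λ _ _ _ → refl)))
      where
        entry : Fin n → Carrier × CMon n 1
        entry i = a i · 1# , cone ⊕ ρ i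

    homog1-coeff : ∀ W → Unique W → ∀ (h : NPoly n) → (∀ x → x ∈ h → All (_∈ W) (monLabels (proj₂ x))) →
                   zcoeff (φ (homog 1 h)) μ ≈ sumOver W (λ i → weigh i (ncoeff h (tree (leaf i))))
    homog1-coeff W unique [] _ = ≈-sym (sumOver-0 W _ λ i _ → ≈-reflexive (pick-0 F (cmon-≟ (ρ i) μ)))
    homog1-coeff W unique ((b , one) ∷ h) uses = homog1-coeff W unique h λ x x∈ → uses x (there x∈)
    homog1-coeff W unique ((b , tree (node t u)) ∷ h) uses with leafCount t + leafCount u ≟ℕ 1
    ... | yes t+u≡1 = ⊥-elim (<-irrefl (sym t+u≡1) (+-mono-≤ (leafCount≥1 t) (leafCount≥1 u)))
    ... | no  _     = homog1-coeff W unique h λ x x∈ → uses x (there x∈)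
    homog1-coeff W unique ((b , tree (leaf i₀)) ∷ h) uses = begin
      zcoeff ((b , φmon (tree (leaf i₀))) ∷ φ (homog 1 h)) μ
        ≈⟨ coeffBy-∷ F cmon-≟ b _ _ μ ⟩
      pick F (cmon-≟ (φmon (tree (leaf i₀))) μ) b +ᶠ zcoeff (φ (homog 1 h)) μ
        ≈⟨ +-cong (contribution-cong μ (≈-refl , φmon-leaf i₀)) (homog1-coeff W unique h λ x x∈ → uses x (there x∈)) ⟩
      weigh i₀ b +ᶠ sumOver W (λ i → weigh i (ncoeff h (tree (leaf i))))
        ≈⟨ +-cong (≈-sym (≈-trans (sumOver-single W single unique i₀∈W single≈0) (≈-reflexive single-i₀))) ≈-refl ⟩
      sumOver W single +ᶠ sumOver W (λ i → weigh i (ncoeff h (tree (leaf i))))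
        ≈⟨ ≈-sym (sumOver-+ W single _) ⟩
      sumOver W (λ i → single i +ᶠ weigh i (ncoeff h (tree (leaf i))))
        ≈⟨ sumOver-cong W (λ i → ≈-sym (≈-trans (pick-cong F (cmon-≟ (ρ i) μ) (coeffBy-∷ F nmon-≟ b (tree (leaf i₀)) h (tree (leaf i))))
                                                (pick-+ F (cmon-≟ (ρ i) μ) _ _))) ⟩
      sumOver W (λ i → weigh i (ncoeff ((b , tree (leaf i₀)) ∷ h) (tree (leaf i)))) ∎
      where
        open ≈-Reasoning setoid
        single : Fin n → Carrier
        single i = weigh i (pick F (nmon-≟ (tree (leaf i₀)) (tree (leaf i))) b)
        i₀∈W : i₀ ∈ W
        i₀∈W = All.head (uses _ (here refl))
        single≈0 : ∀ i → i ≢ i₀ → single i ≈ 0#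
        single≈0 i i≢i₀ = ≈-reflexive (trans (cong (weigh i) (pick-no F (nmon-≟ (tree (leaf i₀)) (tree (leaf i))) b λ { refl → i≢i₀ refl }))
                                             (pick-0 F (cmon-≟ (ρ i) μ)))
        single-i₀ : single i₀ ≡ weigh i₀ b
        single-i₀ = cong (weigh i₀) (pick-yes F (nmon-≟ (tree (leaf i₀)) (tree (leaf i₀))) b refl)

  flat-positioned : ∀ a W g {r} → RPT (flat a W) g r → PositionedOrEmpty r
  flat-positioned a (i ∷ W) zero                (rmul (rcst _) (there (rvar _)))     = inj₂ (leaf (z₁ i) , refl , 0 , 0 , refl , refl)
  flat-positioned a (i ∷ W) (suc zero)          (there (rcst _))                     = inj₁ refl
  flat-positioned a (i ∷ W) (suc (suc zero))    (there (there (rvar _)))             = inj₂ (leaf (z₁ i) , refl , 0 , 0 , refl , refl)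
  flat-positioned a (i ∷ W) (suc (suc (suc g))) (there (there (there p)))            = flat-positioned a W g p

  flatSum-unambiguous : ∀ a W → Unambiguous (flatSum a W)
  flatSum-unambiguous a W = unambiguous-if-positioned F (flatSum a W) λ where
    zero    r (radd _ p) → flat-positioned a W _ p
    (suc g) r (there p)  → flat-positioned a W g p

  flat-depth : ∀ a W g → pdepthAt (flat a W) g ≤ 1
  flat-depth a (i ∷ W) zero                = ≤-refl
  flat-depth a (i ∷ W) (suc zero)          = z≤n
  flat-depth a (i ∷ W) (suc (suc zero))    = z≤n
  flat-depth a (i ∷ W) (suc (suc (suc g))) = flat-depth a W g

  module _ {s} (Ψ : NCircuit n (suc s)) where

    coefficients : Fin n → Carrier
    coefficients i = ncoeff (nOutput Ψ) (tree (leaf i))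

    occurring : List (Fin n)
    occurring = deduplicate _≟F_ (variables Ψ)

    -- The part of degree one of the output is the sum of aᵢ xᵢ over the variables occurring in Ψ.
    linearFlat : ZCircuit n 1 (suc (length occurring * 3))
    linearFlat = flatSum coefficients occurring

    linearFlat-computes : zOutput linearFlat ≈Z φ (homog 1 (nOutput Ψ))
    linearFlat-computes μ = begin
      zcoeff (zOutput linearFlat) μ
        ≡⟨ cong (λ L → zcoeff L μ) (flat-roots coefficients occurring) ⟩
      zcoeff (map (λ i → coefficients i · 1# , cone ⊕ ρ i) occurring) μ
        ≈⟨ flatSum-coeff μ coefficients occurring ⟩
      sumOver occurring (λ i → weigh μ i (coefficients i))
        ≈⟨ homog1-coeff μ occurring (deduplicate-! _≟F_ (variables Ψ)) (nOutput Ψ) occurring-covers ⟨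
      zcoeff (φ (homog 1 (nOutput Ψ))) μ ∎
      where
        open ≈-Reasoning setoid
        occurring-covers : ∀ x → x ∈ nOutput Ψ → All (_∈ occurring) (monLabels (proj₂ x))
        occurring-covers x x∈ = All.map (∈-deduplicate⁺ _≟F_) (evalN-variables Ψ zero x∈)

    linearFlat-depth : 1 ≤ pdepth Ψ → pdepth linearFlat ≤ pdepth Ψ
    linearFlat-depth 1≤d = ≤-trans (maxL-map-≤ _ (roots occurring) λ g _ → flat-depth coefficients occurring g) 1≤d

    linearFlat-size : 1 ≤ pdepth Ψ → size linearFlat ≤ 3 * 1 ^ 4 * size Ψ
    linearFlat-size 1≤d = begin
      suc (length occurring * 3) ≤⟨ s≤s (*-monoˡ-≤ 3 (≤-trans (length-deduplicate _≟F_ (variables Ψ)) (length-variables-≤ Ψ 1≤d))) ⟩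
      suc (s * 3)                ≤⟨ m≤n+m _ 2 ⟩
      suc s * 3                  ≡⟨ *-comm (suc s) 3 ⟩
      3 * suc s                  ∎
      where open ≤-Reasoning

mainTheorem13 : ∀ {c ℓ} (F : Field c ℓ) → let open Poly F in
    (n d : ℕ) → 1 ≤ d →
    ∀ {s} (Ψ : NCircuit n (suc s)) (d′ : ℕ) → d′ ≤ d →
    HasDegree (nOutput Ψ) d′ →
    Σ ℕ λ s′ → Σ (ZCircuit n d (suc s′)) λ Ψ′ →
      Unambiguous Ψ′ ×
      zOutput Ψ′ ≈Z φ (homog d′ (nOutput Ψ)) ×
      size Ψ′ ≤ 3 * d ^ 4 * size Ψ ×
      pdepth Ψ′ ≤ pdepth Ψ
mainTheorem13 F n d@(suc (suc _)) _ Ψ d′ d′≤d _ =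
  let open SlotCircuit F n d Ψ d′ d′≤d in
  _ , Ψ′ , unambiguous , computes , size-bound (s≤s (s≤s z≤n)) , depth-preserved
mainTheorem13 F n 1 _ Ψ 0 _ _ =
  let open ConstantPart F n 1; f = Poly.nOutput F Ψ in
  0 , constantPart f , constantPart-unambiguous f , constantPart-computes f , s≤s z≤n , z≤n
mainTheorem13 F n 1 _ {s} Ψ 1 _ _ with pdepth Ψ ≟ℕ 0
... | yes depth≡0 = let open LinearPart F n in
  s , linearPart Ψ , linearPart-unambiguous Ψ , linearPart-computes Ψ depth≡0 , m≤m+n _ _ , linearPart-pdepth Ψ
... | no  depth≢0 = let open FlatLinearPart F n in
  _ , linearFlat Ψ , flatSum-unambiguous _ _ , linearFlat-computes Ψ , linearFlat-size Ψ 1≤depth , linearFlat-depth Ψ 1≤depth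
  where 1≤depth = n≢0⇒n>0 depth≢0
mainTheorem13 F n 1 _ Ψ (suc (suc _)) (s≤s ()) _
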